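{- Let $M=(E,\mathcal I)$ be a loopless matroid with rank function $r$ and base family $\mathcal B$, let $\widetilde{\mathcal B}$ be a Fulkerson dual family of $\mathcal B$, let $\mu^*$ be an optimal probability mass function for $\mathrm{MEO}(\mathcal B)$, and let $\eta^*(e)=\sum_{B\ni e}\mu^*(B)$, which is the optimal density for $\mathrm{Mod}_2(\widetilde{\mathcal B})$. Let $\eta^*_{\max}=\max_{e\in E}\eta^*(e)$ and $X=E_{\max}=\{e\in E:\eta^*(e)=\eta^*_{\max}\}$. Then: (1) $X$ is a Beurling set, i.e. $\eta^*(X)=r(E)-r(E\setminus X)$; (2) $\mathrm{cl}(E\setminus X)=E\setminus X$; (3) $\eta^*_{\max}=\dfrac{r(E)-r(E\setminus X)}{|X|}$; (4) $\eta^*_{\max}=1/S(M)$; (5) the contraction $M/(E\setminus E_{\max})$ is homogeneous.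
   Context: A matroid $M=(E,\mathcal I)$ on a finite set $E$ has rank function $r$, base family $\mathcal B$, closure $\mathrm{cl}(Z)=\{y:r(Z\cup\{y\})=r(Z)\}$. Standing assumption: $r(E)>0$. Contraction $M/(E\setminus X)$: matroid on $X$ with rank function $Y\mapsto r(Y\cup(E\setminus X))-r(E\setminus X)$. Strength: $S(M)=\min\{|X|/(r(E)-r(E\setminus X)):X\subseteq E,\ r(E)>r(E\setminus X)\}$. Bases are identified with indicator vectors; $\eta(A)=\sum_{e\in A}\eta(e)$. For $\Gamma\subseteq\mathbb R^F_{\ge0}$ ($F$ finite), $\mathrm{Adm}(\Gamma)=\{\rho\in\mathbb R^F_{\ge0}:\sum_e\gamma(e)\rho(e)\ge1\ \forall\gamma\in\Gamma\}$, $\mathrm{Mod}_2(\Gamma)=\min\{\sum_e\rho(e)^2:\rho\in\mathrm{Adm}(\Gamma)\}$ with unique minimizer (optimal density). $\mathrm{BL}(K)=\{\eta\ge0:\eta^T\rho\ge1\ \forall\rho\in K\}$; $\widetilde{\mathcal B}$ is a Fulkerson dual family of $\mathcal B$ if $\mathrm{Adm}(\widetilde{\mathcal B})=\mathrm{BL}(\mathrm{Adm}(\mathcal B))$. $\mathrm{MEO}(\mathcal B)=\min_\mu\sum_{B,B'}\mu(B)\mu(B')|B\cap B'|$ over pmfs $\mu$ on $\mathcal B$. A matroid $N$ is homogeneous if the optimal density for $\mathrm{Mod}_2$ of a Fulkerson dual family of its base family is constant.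
   Formalization: The optimal probability mass function μ*, the Fulkerson dual family $\widetilde{\mathcal B}$, and the families and densities in the definition of homogeneous take rational values rather than real ones. -}

module Defs where

open import Data.Bool using (Bool; true; false; _∧_; _∨_; not; if_then_else_)
open import Data.Nat as ℕ using (ℕ; zero; suc)
open import Data.Integer using (ℤ; +_; +[1+_]; -[1+_])
open import Data.Rational using (ℚ; mkℚ; _+_; _*_; _-_; _÷_; _⊔_; _⊓_; _≤_; 0ℚ; 1ℚ)
open import Data.Rational.Properties using (_≟_)
open import Data.Fin using (Fin)
open import Data.Fin.Subset using (Subset; _∈_; _∉_; _⊆_; _∪_; _∩_; ⁅_⁆; ∁; ∣_∣; ⊤; ⊥)
open import Data.Fin.Subset.Properties using (_⊆?_)
open import Data.Vec using (Vec; []; _∷_; lookup; tabulate)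
open import Data.List using (List; []; _∷_; map; _++_; foldr; allFin; filter)
open import Data.List using () renaming ([_] to [_]ₗ)
open import Data.Product using (Σ; ∃; ∃-syntax; _×_; _,_)
open import Relation.Nullary using (¬_; Dec; yes; no)
open import Relation.Nullary.Decidable using (⌊_⌋)
open import Relation.Binary.PropositionalEquality using (_≡_)
open import Function.Bundles using (_⇔_)

fromℕ : ℕ → ℚ
fromℕ n = Data.Rational._/_ (+ n) 1

sumℚ : List ℚ → ℚ
sumℚ = foldr _+_ 0ℚ

Σ[_] : ∀ {n} → (Fin n → ℚ) → ℚ
Σ[_] {n} f = sumℚ (map f (allFin n))

subsets : ∀ n → List (Subset n)
subsets zero    = [ [] ]ₗ
subsets (suc n) = map (false ∷_) (subsets n) ++ map (true ∷_) (subsets n)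

ΣS[_] : ∀ {n} → (Subset n → ℚ) → ℚ
ΣS[_] {n} f = sumℚ (map f (subsets n))

-- Total division on ℚ (returns 0 when dividing by 0; only used with
-- nonzero denominators in the statement).
divℚ : ℚ → ℚ → ℚ
divℚ p q@(mkℚ +[1+ _ ] _ _) = p ÷ q
divℚ p q@(mkℚ -[1+ _ ] _ _) = p ÷ q
divℚ p (mkℚ (+ zero) _ _)   = 0ℚ

record Matroid (n : ℕ) : Set where
  field
    indep      : Subset n → Bool
    indep-∅    : indep ⊥ ≡ true
    indep-↓    : ∀ {A B} → A ⊆ B → indep B ≡ true → indep A ≡ true
    indep-aug  : ∀ {A B} → indep A ≡ true → indep B ≡ true → ∣ A ∣ ℕ.< ∣ B ∣ →
                 ∃[ e ] (e ∈ B × e ∉ A × indep (A ∪ ⁅ e ⁆) ≡ true)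

module _ {n : ℕ} (M : Matroid n) where
  open Matroid M

  rank : Subset n → ℕ
  rank X = foldr ℕ._⊔_ 0 (map ∣_∣ (filter (λ Y → Y ⊆? X) (Data.List.filter (λ Y → indep Y Data.Bool.≟ true) (subsets n))))

  cl : Subset n → Subset n
  cl Z = tabulate (λ y → ⌊ rank (Z ∪ ⁅ y ⁆) ℕ.≟ rank Z ⌋)

  Loopless : Set
  Loopless = ∀ e → indep ⁅ e ⁆ ≡ true

  strength : ℚ
  strength = foldr _⊓_ (divℚ (fromℕ n) (fromℕ (rank ⊤)))
               (map (λ X → divℚ (fromℕ ∣ X ∣) (fromℕ (rank ⊤) - fromℕ (rank (∁ X))))
                    (filter (λ X → rank (∁ X) ℕ.<? rank ⊤) (subsets n)))

IsBase : ∀ {n} → (Subset n → Bool) → Subset n → Set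
IsBase ind B = ind B ≡ true × (∀ e → e ∉ B → ind (B ∪ ⁅ e ⁆) ≡ false)

indicator : ∀ {n} → Subset n → Fin n → ℚ
indicator B e = if lookup B e then 1ℚ else 0ℚ

Family : ℕ → Set₁
Family k = (Fin k → ℚ) → Set

BaseFamily : ∀ {n} → (Subset n → Bool) → Family n
BaseFamily ind γ = Σ _ λ B → IsBase ind B × (∀ e → γ e ≡ indicator B e)

NonNeg : ∀ {k} → (Fin k → ℚ) → Set
NonNeg ρ = ∀ e → 0ℚ ≤ ρ e

dot : ∀ {k} → (Fin k → ℚ) → (Fin k → ℚ) → ℚ
dot γ ρ = Σ[ (λ e → γ e * ρ e) ]

Adm : ∀ {k} → Family k → Family k
Adm Γ ρ = NonNeg ρ × (∀ γ → Γ γ → 1ℚ ≤ dot γ ρ)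

BL : ∀ {k} → Family k → Family k
BL K η = NonNeg η × (∀ ρ → K ρ → 1ℚ ≤ dot η ρ)

FulkersonDual : ∀ {k} → Family k → Family k → Set
FulkersonDual Γ̃ Γ = (∀ γ → Γ̃ γ → NonNeg γ) × (∀ ρ → Adm Γ̃ ρ ⇔ BL (Adm Γ) ρ)

energy : ∀ {k} → (Fin k → ℚ) → ℚ
energy ρ = Σ[ (λ e → ρ e * ρ e) ]

IsOptimalDensity : ∀ {k} → Family k → (Fin k → ℚ) → Set
IsOptimalDensity Γ ρ = Adm Γ ρ × (∀ ρ' → Adm Γ ρ' → energy ρ ≤ energy ρ')

Homogeneous : ∀ {k} → (Subset k → Bool) → Set₁
Homogeneous {k} ind =
  ∀ (Γ̃ : Family k) → FulkersonDual Γ̃ (BaseFamily ind) →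
  ∀ ρ → IsOptimalDensity Γ̃ ρ → ∀ e e' → ρ e ≡ ρ e'

IsPMF : ∀ {n} → (Subset n → Bool) → (Subset n → ℚ) → Set
IsPMF ind μ = (∀ B → 0ℚ ≤ μ B) × (∀ B → ¬ IsBase ind B → μ B ≡ 0ℚ) × ΣS[ μ ] ≡ 1ℚ

meoObj : ∀ {n} → (Subset n → ℚ) → ℚ
meoObj μ = ΣS[ (λ B → ΣS[ (λ B' → μ B * μ B' * fromℕ ∣ B ∩ B' ∣) ]) ]

IsOptimalMEO : ∀ {n} → (Subset n → Bool) → (Subset n → ℚ) → Set
IsOptimalMEO ind μ = IsPMF ind μ × (∀ ν → IsPMF ind ν → meoObj μ ≤ meoObj ν)

edgeUsage : ∀ {n} → (Subset n → ℚ) → Fin n → ℚ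
edgeUsage μ e = ΣS[ (λ B → if lookup B e then μ B else 0ℚ) ]

-- η_max = max_e η(e)  (the η here is nonnegative, so 0 is a safe seed)
maxℚ : ∀ {n} → (Fin n → ℚ) → ℚ
maxℚ {n} η = foldr _⊔_ 0ℚ (map η (allFin n))

measure : ∀ {n} → (Fin n → ℚ) → Subset n → ℚ
measure η A = Σ[ (λ e → if lookup A e then η e else 0ℚ) ]

argmaxSet : ∀ {n} → (Fin n → ℚ) → Subset n
argmaxSet η = tabulate (λ e → ⌊ η e ≟ maxℚ η ⌋)

-- Contraction M/(E∖X), relabelled along an injection ι : Fin k → Fin n
-- whose image is X.  Its rank function is Y ↦ r(ι(Y) ∪ (E∖X)) − r(E∖X),
-- and Y is independent iff its rank equals |Y|.

image : ∀ {k n} → (Fin k → Fin n) → Subset k → Subset n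
image {k} ι Y = tabulate (λ e → foldr _∨_ false
                  (map (λ j → lookup Y j ∧ ⌊ ι j Data.Fin.≟ e ⌋) (allFin k)))

contractIndep : ∀ {n k} → Matroid n → Subset n → (Fin k → Fin n) → Subset k → Bool
contractIndep M X ι Y =
  ⌊ rank M (image ι Y ∪ ∁ X) ℕ.∸ rank M (∁ X) ℕ.≟ ∣ Y ∣ ⌋

Enumerates : ∀ {n k} → (Fin k → Fin n) → Subset n → Set
Enumerates ι X = (∀ i j → ι i ≡ ι j → i ≡ j) × (∀ e → e ∈ X ⇔ (∃[ j ] ι j ≡ e))

{-# OPTIONS --safe #-}
-- Shifting a little mass δ from a base B in the support of μ to a base B′ changes the MEO
-- objective Σ η² by 2δ (η(B′) − η(B)) + O(δ²), so every base in the support has minimum η-weight.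
-- Such a base meets E ∖ X in a maximal independent subset of E ∖ X: otherwise B ∩ (E ∖ X) could be
-- augmented inside E ∖ X and extended to a base of smaller weight, since η < ηmax off X. Hence
-- |B ∩ X| = r(E) − r(E ∖ X) on the support, and averaging over μ gives (1); (3) follows because
-- η = ηmax on X, and (2) because every y ∈ X lies in some base of the support. Every base meets a
-- set A in at least r(E) − r(E ∖ A) elements, so r(E) − r(E ∖ A) ≤ η(A) ≤ ηmax |A|, with equality
-- for A = X; this is (4). For (5), the support bases restrict to bases of M/(E ∖ X), so the constant
-- density ηmax lies in the blocker and hence is admissible for the dual family, while the uniform
-- density 1/(r(E) − r(E ∖ X)) is admissible for the bases; comparing energies and sums then forces
-- the optimal density to equal ηmax everywhere.
module Submission where

open import Defs
open import Data.Bool using (Bool; true; false; T; if_then_else_; _∧_; _∨_; not)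
import Data.Bool as Bool
open import Data.Bool.Properties using (∨-identityʳ; T-≡; T-∧)
open import Data.Bool.ListAction using (any)
open import Data.Nat as ℕ using (ℕ; zero; suc; _∸_)
import Data.Nat.Properties as ℕ
open import Data.Integer as ℤ using (+[1+_]; -[1+_])
import Data.Integer.Properties as ℤ
open import Data.Rational using (ℚ; mkℚ; toℚᵘ; *<*; _+_; _*_; _-_; -_; _≤_; _<_; 0ℚ; 1ℚ; 1/_; _⊔_; _⊓_; positive; negative; nonNegative; nonPositive)
open import Data.Rational.Properties
open import Data.Rational.Unnormalised as ℚᵘ using (mkℚᵘ; *≡*)
import Data.Rational.Unnormalised.Properties as ℚᵘ
open import Data.Rational.Solver using (module +-*-Solver)
open import Data.List using (List; []; _∷_; map; _++_; foldr; filter; allFin)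
import Data.List.Properties as List
open import Data.List.Membership.Propositional using () renaming (_∈_ to _∈ₗ_)
open import Data.List.Membership.Propositional.Properties using (∈-map⁺; ∈-++⁺ˡ; ∈-++⁺ʳ; ∈-filter⁺; ∈-filter⁻; ∈-allFin)
open import Data.List.Relation.Unary.Any as Any using (here; there; satisfied)
open import Data.List.Relation.Unary.Any.Properties using (any⁺; any⁻)
open import Data.Fin using (Fin; zero; suc)
import Data.Fin.Properties as Fin
open import Data.Vec using ([]; _∷_; here; there; lookup; tabulate; tail)
import Data.Vec.Properties as Vec
open import Data.Fin.Subset using (Subset; inside; outside; _∈_; _∉_; _⊆_; _∩_; _∪_; ∁; ⁅_⁆; ∣_∣; ⊤; ⊥)
open import Data.Fin.Subset.Properties
open import Data.Product using (∃-syntax; _×_; _,_; proj₁; proj₂)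
open import Data.Sum using (_⊎_; inj₁; inj₂)
open import Data.Empty using (⊥-elim)
open import Function using (_∘_)
open import Function.Bundles using (Equivalence)
open import Relation.Nullary using (¬_; Dec; yes; no; contradiction)
open import Relation.Nullary.Decidable using (⌊_⌋; _×-dec_; _→-dec_; ¬?; dec-true; dec-false; isYes≗does; toWitness)
open import Relation.Binary.Definitions using (tri<; tri≈; tri>)
open import Relation.Binary.PropositionalEquality

open +-*-Solver using (solve; _:+_; _:*_; _:-_; :-_; _:=_; con)

private
  variable
    A B : Set
    n : ℕ

⌊⌋-true : ∀ {P : Set} (P? : Dec P) → P → ⌊ P? ⌋ ≡ true
⌊⌋-true P? p = trans (isYes≗does P?) (dec-true P? p)

⌊⌋-false : ∀ {P : Set} (P? : Dec P) → ¬ P → ⌊ P? ⌋ ≡ false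
⌊⌋-false P? ¬p = trans (isYes≗does P?) (dec-false P? ¬p)

⌊⌋-true⁻ : ∀ {P : Set} (P? : Dec P) → ⌊ P? ⌋ ≡ true → P
⌊⌋-true⁻ (yes p) _ = p

-- Rational arithmetic

fromℕ-+ : ∀ a b → fromℕ (a ℕ.+ b) ≡ fromℕ a + fromℕ b
fromℕ-+ a b = toℚᵘ-injective (begin-equality
  toℚᵘ (fromℕ (a ℕ.+ b))                 ≃⟨ toℚᵘ-fromℚᵘ (mkℚᵘ (ℤ.+ (a ℕ.+ b)) 0) ⟩
  mkℚᵘ (ℤ.+ (a ℕ.+ b)) 0                 ≃⟨ *≡* (cong (ℤ._* ℤ.+ 1) integral) ⟩
  mkℚᵘ (ℤ.+ a) 0 ℚᵘ.+ mkℚᵘ (ℤ.+ b) 0     ≃⟨ ℚᵘ.+-cong (toℚᵘ-fromℚᵘ (mkℚᵘ (ℤ.+ a) 0)) (toℚᵘ-fromℚᵘ (mkℚᵘ (ℤ.+ b) 0)) ⟨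
  toℚᵘ (fromℕ a) ℚᵘ.+ toℚᵘ (fromℕ b)     ≃⟨ toℚᵘ-homo-+ (fromℕ a) (fromℕ b) ⟨
  toℚᵘ (fromℕ a + fromℕ b)               ∎)
  where
  open ℚᵘ.≤-Reasoning
  integral : ℤ.+ (a ℕ.+ b) ≡ ℤ.+ a ℤ.* ℤ.+ 1 ℤ.+ ℤ.+ b ℤ.* ℤ.+ 1
  integral = sym (cong₂ ℤ._+_ (ℤ.*-identityʳ (ℤ.+ a)) (ℤ.*-identityʳ (ℤ.+ b)))

fromℕ-suc : ∀ a → fromℕ (suc a) ≡ 1ℚ + fromℕ a
fromℕ-suc = fromℕ-+ 1

0≤fromℕ : ∀ a → 0ℚ ≤ fromℕ a
0≤fromℕ a = nonNegative⁻¹ (fromℕ a) {{normalize-nonNeg a 1}}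

p<1+p : ∀ p → p < 1ℚ + p
p<1+p p = subst (_< 1ℚ + p) (+-identityˡ p) (+-monoˡ-< p (positive⁻¹ 1ℚ))

fromℕ-mono-≤ : ∀ {a b} → a ℕ.≤ b → fromℕ a ≤ fromℕ b
fromℕ-mono-≤ {a} a≤b with ℕ.m≤n⇒∃[o]m+o≡n a≤b
... | d , refl = subst₂ _≤_ (+-identityʳ (fromℕ a)) (sym (fromℕ-+ a d)) (+-monoʳ-≤ (fromℕ a) (0≤fromℕ d))

fromℕ-mono-< : ∀ {a b} → a ℕ.< b → fromℕ a < fromℕ b
fromℕ-mono-< {a} {suc b} (ℕ.s≤s a≤b) =
  <-≤-trans (p<1+p (fromℕ a)) (subst (1ℚ + fromℕ a ≤_) (sym (fromℕ-suc b)) (+-monoʳ-≤ 1ℚ (fromℕ-mono-≤ a≤b)))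

fromℕ-cancel-< : ∀ {a b} → fromℕ a < fromℕ b → a ℕ.< b
fromℕ-cancel-< {a} {b} lt = ℕ.≰⇒> (λ b≤a → <-irrefl refl (<-≤-trans lt (fromℕ-mono-≤ b≤a)))

fromℕ-injective : ∀ {a b} → fromℕ a ≡ fromℕ b → a ≡ b
fromℕ-injective {a} {b} eq with ℕ.<-cmp a b
... | tri< a<b _ _ = ⊥-elim (<-irrefl eq (fromℕ-mono-< a<b))
... | tri≈ _ a≡b _ = a≡b
... | tri> _ _ b<a = ⊥-elim (<-irrefl (sym eq) (fromℕ-mono-< b<a))

fromℕ-∸ : ∀ {a b} → b ℕ.≤ a → fromℕ (a ℕ.∸ b) ≡ fromℕ a - fromℕ b
fromℕ-∸ {a} {b} b≤a = begin
  fromℕ (a ℕ.∸ b)                        ≡⟨ solve 2 (λ x y → x := (x :+ y) :- y) refl (fromℕ (a ℕ.∸ b)) (fromℕ b) ⟩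
  fromℕ (a ℕ.∸ b) + fromℕ b - fromℕ b    ≡⟨ cong (_- fromℕ b) (sym (fromℕ-+ (a ℕ.∸ b) b)) ⟩
  fromℕ (a ℕ.∸ b ℕ.+ b) - fromℕ b        ≡⟨ cong (λ x → fromℕ x - fromℕ b) (ℕ.m∸n+n≡m b≤a) ⟩
  fromℕ a - fromℕ b                      ∎
  where open ≡-Reasoning

p≤q⇒0≤q-p : ∀ {p q} → p ≤ q → 0ℚ ≤ q - p
p≤q⇒0≤q-p {p} {q} p≤q = subst (_≤ q - p) (+-inverseʳ p) (+-monoˡ-≤ (- p) p≤q)

p<q⇒0<q-p : ∀ {p q} → p < q → 0ℚ < q - p
p<q⇒0<q-p {p} {q} p<q = subst (_< q - p) (+-inverseʳ p) (+-monoˡ-< (- p) p<q)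

0<q-p⇒p<q : ∀ {p q} → 0ℚ < q - p → p < q
0<q-p⇒p<q {p} {q} 0<q-p = subst₂ _<_ (+-identityʳ p) (solve 2 (λ p q → p :+ (q :- p) := q) refl p q) (+-monoʳ-< p 0<q-p)

≤∧≢⇒< : ∀ {p q} → p ≤ q → ¬ p ≡ q → p < q
≤∧≢⇒< {p} {q} p≤q p≢q with <-cmp p q
... | tri< p<q _ _ = p<q
... | tri≈ _ p≡q _ = ⊥-elim (p≢q p≡q)
... | tri> _ _ q<p = ⊥-elim (<-irrefl refl (<-≤-trans q<p p≤q))

0≤p*q : ∀ {p q} → 0ℚ ≤ p → 0ℚ ≤ q → 0ℚ ≤ p * q
0≤p*q {p} {q} 0≤p 0≤q = nonNegative⁻¹ (p * q) {{nonNeg*nonNeg⇒nonNeg p {{nonNegative 0≤p}} q {{nonNegative 0≤q}}}}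

0<p*q : ∀ {p q} → 0ℚ < p → 0ℚ < q → 0ℚ < p * q
0<p*q {p} {q} 0<p 0<q = positive⁻¹ (p * q) {{pos*pos⇒pos p {{positive 0<p}} q {{positive 0<q}}}}

0≤p*p : ∀ p → 0ℚ ≤ p * p
0≤p*p p with ≤-total 0ℚ p
... | inj₁ 0≤p = 0≤p*q 0≤p 0≤p
... | inj₂ p≤0 = nonNegative⁻¹ (p * p) {{nonPos*nonPos⇒nonPos p {{nonPositive p≤0}} p {{nonPositive p≤0}}}}

p*p≤0⇒p≡0 : ∀ p → p * p ≤ 0ℚ → p ≡ 0ℚ
p*p≤0⇒p≡0 p p*p≤0 with <-cmp p 0ℚ
... | tri≈ _ p≡0 _ = p≡0
... | tri< p<0 _ _ = ⊥-elim (<-irrefl refl (<-≤-trans (positive⁻¹ (p * p) {{neg*neg⇒pos p {{negative p<0}} p {{negative p<0}}}}) p*p≤0))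
... | tri> _ _ 0<p = ⊥-elim (<-irrefl refl (<-≤-trans (0<p*q 0<p 0<p) p*p≤0))

divℚ-*-cancel : ∀ p {q} → 0ℚ < q → divℚ p q * q ≡ p
divℚ-*-cancel p {q@(mkℚ +[1+ _ ] _ _)} _ =
  trans (*-assoc p (1/ q) q) (trans (cong (p *_) (*-inverseˡ q)) (*-identityʳ p))
divℚ-*-cancel p {mkℚ (ℤ.+ zero) _ _} (*<* (ℤ.+<+ ()))
divℚ-*-cancel p {mkℚ -[1+ _ ] _ _} (*<* ())

divℚ-unique : ∀ {p q} x → 0ℚ < q → x * q ≡ p → divℚ p q ≡ x
divℚ-unique {p} {q@(mkℚ +[1+ _ ] _ _)} x _ refl =
  trans (*-assoc x q (1/ q)) (trans (cong (x *_) (*-inverseʳ q)) (*-identityʳ x))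
divℚ-unique {q = mkℚ (ℤ.+ zero) _ _} x (*<* (ℤ.+<+ ())) _
divℚ-unique {q = mkℚ -[1+ _ ] _ _} x (*<* ()) _

divℚ-pos : ∀ {p q} → 0ℚ < p → 0ℚ < q → 0ℚ < divℚ p q
divℚ-pos {p} {q@(mkℚ +[1+ _ ] _ _)} 0<p _ =
  0<p*q 0<p (positive⁻¹ (1/ q) {{1/pos⇒pos q}})
divℚ-pos {q = mkℚ (ℤ.+ zero) _ _} _ (*<* (ℤ.+<+ ()))
divℚ-pos {q = mkℚ -[1+ _ ] _ _} _ (*<* ())

1/c≤a/d : ∀ {a c d} → 0ℚ < c → 0ℚ < d → d ≤ c * a → divℚ 1ℚ c ≤ divℚ a d
1/c≤a/d {a} {c} {d} 0<c 0<d d≤ca = ≮⇒≥ (λ a/d<1/c → <-irrefl refl (begin-strict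
  a                       ≡⟨ sym (divℚ-*-cancel a 0<d) ⟩
  divℚ a d * d            <⟨ *-monoˡ-<-pos d {{positive 0<d}} a/d<1/c ⟩
  divℚ 1ℚ c * d           ≤⟨ *-monoˡ-≤-nonNeg (divℚ 1ℚ c) {{nonNegative (<⇒≤ (divℚ-pos (positive⁻¹ 1ℚ) 0<c))}} d≤ca ⟩
  divℚ 1ℚ c * (c * a)     ≡⟨ sym (*-assoc (divℚ 1ℚ c) c a) ⟩
  divℚ 1ℚ c * c * a       ≡⟨ cong (_* a) (divℚ-*-cancel 1ℚ 0<c) ⟩
  1ℚ * a                  ≡⟨ *-identityˡ a ⟩
  a                       ∎))
  where open ≤-Reasoning

∃-small-step : ∀ {a D C} → 0ℚ < a → 0ℚ < D → 0ℚ ≤ C → ∃[ δ ] (0ℚ < δ × δ ≤ a × δ * C ≤ D)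
∃-small-step {a} {D} {C} 0<a 0<D 0≤C = δ , 0<δ , p⊓q≤p a D/[1+C] , δC≤D
  where
  0<1+C : 0ℚ < 1ℚ + C
  0<1+C = <-≤-trans (positive⁻¹ 1ℚ) (subst (_≤ 1ℚ + C) (+-identityʳ 1ℚ) (+-monoʳ-≤ 1ℚ 0≤C))
  D/[1+C] : ℚ
  D/[1+C] = divℚ D (1ℚ + C)
  δ : ℚ
  δ = a ⊓ D/[1+C]
  0<δ : 0ℚ < δ
  0<δ with ⊓-sel a D/[1+C]
  ... | inj₁ δ≡a = subst (0ℚ <_) (sym δ≡a) 0<a
  ... | inj₂ δ≡D/[1+C] = subst (0ℚ <_) (sym δ≡D/[1+C]) (divℚ-pos 0<D 0<1+C)
  δC≤D : δ * C ≤ D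
  δC≤D = begin
    δ * C                   ≤⟨ *-monoˡ-≤-nonNeg δ {{nonNegative (<⇒≤ 0<δ)}}
                               (subst (_≤ 1ℚ + C) (+-identityˡ C) (+-monoˡ-≤ C (<⇒≤ (positive⁻¹ 1ℚ)))) ⟩
    δ * (1ℚ + C)            ≤⟨ *-monoʳ-≤-nonNeg (1ℚ + C) {{nonNegative (<⇒≤ 0<1+C)}} (p⊓q≤q a D/[1+C]) ⟩
    D/[1+C] * (1ℚ + C)      ≡⟨ divℚ-*-cancel D 0<1+C ⟩
    D                       ∎
    where open ≤-Reasoning

quadratic-step-decreases : ∀ E {δ D C} → 0ℚ < δ → 0ℚ < D → δ * C ≤ D → E + (δ + δ) * (- D) + δ * δ * C < E
quadratic-step-decreases E {δ} {D} {C} 0<δ 0<D δC≤D = begin-strict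
  E + (δ + δ) * (- D) + δ * δ * C    ≡⟨ cong ((E + (δ + δ) * (- D)) +_) (*-assoc δ δ C) ⟩
  E + (δ + δ) * (- D) + δ * (δ * C)  ≤⟨ +-monoʳ-≤ (E + (δ + δ) * (- D)) (*-monoˡ-≤-nonNeg δ {{nonNegative (<⇒≤ 0<δ)}} δC≤D) ⟩
  E + (δ + δ) * (- D) + δ * D        ≡⟨ solve 3 (λ E δ D → E :+ (δ :+ δ) :* (:- D) :+ δ :* D := E :- δ :* D) refl E δ D ⟩
  E - δ * D                          <⟨ subst (E - δ * D <_) (+-identityʳ E)
                                        (+-monoʳ-< E
                                        (neg-antimono-< (0<p*q 0<δ 0<D))) ⟩
  E                                  ∎
  where open ≤-Reasoning

-- Finite sums

sumOver : List A → (A → ℚ) → ℚ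
sumOver xs f = sumℚ (map f xs)

sum-cong : ∀ (xs : List A) {f g} → (∀ x → f x ≡ g x) → sumOver xs f ≡ sumOver xs g
sum-cong []       f≗g = refl
sum-cong (x ∷ xs) f≗g = cong₂ _+_ (f≗g x) (sum-cong xs f≗g)

sum-zero : ∀ (xs : List A) → sumOver xs (λ _ → 0ℚ) ≡ 0ℚ
sum-zero []       = refl
sum-zero (x ∷ xs) = trans (+-identityˡ _) (sum-zero xs)

sum-+ : ∀ (xs : List A) f g → sumOver xs (λ x → f x + g x) ≡ sumOver xs f + sumOver xs g
sum-+ []       f g = refl
sum-+ (x ∷ xs) f g = trans (cong (f x + g x +_) (sum-+ xs f g))
  (solve 4 (λ a b c d → (a :+ b) :+ (c :+ d) := (a :+ c) :+ (b :+ d)) refl (f x) (g x) (sumOver xs f) (sumOver xs g))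

sum-*ˡ : ∀ (xs : List A) c f → sumOver xs (λ x → c * f x) ≡ c * sumOver xs f
sum-*ˡ []       c f = sym (*-zeroʳ c)
sum-*ˡ (x ∷ xs) c f = trans (cong (c * f x +_) (sum-*ˡ xs c f)) (sym (*-distribˡ-+ c (f x) (sumOver xs f)))

sum-- : ∀ (xs : List A) f g → sumOver xs (λ x → f x - g x) ≡ sumOver xs f - sumOver xs g
sum-- []       f g = refl
sum-- (x ∷ xs) f g = trans (cong (f x - g x +_) (sum-- xs f g))
  (solve 4 (λ a b c d → (a :- b) :+ (c :- d) := (a :+ c) :- (b :+ d)) refl (f x) (g x) (sumOver xs f) (sumOver xs g))

sum-++ : ∀ (xs ys : List A) f → sumOver (xs ++ ys) f ≡ sumOver xs f + sumOver ys f
sum-++ []       ys f = sym (+-identityˡ _)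
sum-++ (x ∷ xs) ys f = trans (cong (f x +_) (sum-++ xs ys f)) (sym (+-assoc (f x) _ _))

sum-map : ∀ (xs : List B) (g : B → A) f → sumOver (map g xs) f ≡ sumOver xs (λ x → f (g x))
sum-map xs g f = cong sumℚ (sym (List.map-∘ xs))

sum-swap : ∀ (xs : List A) (ys : List B) (f : A → B → ℚ) →
           sumOver xs (λ x → sumOver ys (f x)) ≡ sumOver ys (λ y → sumOver xs (λ x → f x y))
sum-swap []       ys f = sym (sum-zero ys)
sum-swap (x ∷ xs) ys f = trans (cong (sumOver ys (f x) +_) (sum-swap xs ys f))
  (sym (sum-+ ys (f x) (λ y → sumOver xs (λ x → f x y))))

sum-mono-≤ : ∀ (xs : List A) {f g} → (∀ x → f x ≤ g x) → sumOver xs f ≤ sumOver xs g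
sum-mono-≤ []       f≤g = ≤-refl
sum-mono-≤ (x ∷ xs) f≤g = +-mono-≤ (f≤g x) (sum-mono-≤ xs f≤g)

sum-nonNeg : ∀ (xs : List A) {f} → (∀ x → 0ℚ ≤ f x) → 0ℚ ≤ sumOver xs f
sum-nonNeg xs {f} 0≤f = subst (_≤ sumOver xs f) (sum-zero xs) (sum-mono-≤ xs 0≤f)

term≤sum : ∀ {xs : List A} {f} → (∀ x → 0ℚ ≤ f x) → ∀ {x} → x ∈ₗ xs → f x ≤ sumOver xs f
term≤sum {xs = y ∷ xs} {f} 0≤f (here refl) =
  subst (_≤ f y + sumOver xs f) (+-identityʳ (f y)) (+-monoʳ-≤ (f y) (sum-nonNeg xs 0≤f))
term≤sum {xs = y ∷ xs} {f} 0≤f (there x∈xs) =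
  subst (_≤ f y + sumOver xs f) (+-identityˡ _) (+-mono-≤ (0≤f y) (term≤sum 0≤f x∈xs))

sum≢0⇒term≢0 : ∀ (xs : List A) f → ¬ sumOver xs f ≡ 0ℚ → ∃[ x ] ¬ f x ≡ 0ℚ
sum≢0⇒term≢0 []       f sum≢0 = ⊥-elim (sum≢0 refl)
sum≢0⇒term≢0 (x ∷ xs) f sum≢0 with f x ≟ 0ℚ
... | no fx≢0 = x , fx≢0
... | yes fx≡0 = sum≢0⇒term≢0 xs f (λ rest≡0 → sum≢0 (cong₂ _+_ fx≡0 rest≡0))

Σ-suc : ∀ {n} (f : Fin (suc n) → ℚ) → Σ[ f ] ≡ f zero + Σ[ f ∘ suc ]
Σ-suc {n} f = cong (λ xs → f zero + sumℚ xs)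
  (trans (List.map-tabulate suc f) (sym (List.map-tabulate (λ i → i) (f ∘ suc))))

Σ-delta : ∀ {n} (f : Fin n → ℚ) i → (∀ j → ¬ j ≡ i → f j ≡ 0ℚ) → Σ[ f ] ≡ f i
Σ-delta {suc n} f zero    off = trans (Σ-suc f)
  (trans (cong (f zero +_) (trans (sum-cong (allFin n) (λ j → off (suc j) (λ ()))) (sum-zero (allFin n))))
         (+-identityʳ (f zero)))
Σ-delta {suc n} f (suc i) off = trans (Σ-suc f)
  (trans (cong₂ _+_ (off zero (λ ())) (Σ-delta (f ∘ suc) i (λ j j≢i → off (suc j) (j≢i ∘ Fin.suc-injective))))
         (+-identityˡ (f (suc i))))

ΣS-cons : ∀ {n} (f : Subset (suc n) → ℚ) → ΣS[ f ] ≡ ΣS[ f ∘ (outside ∷_) ] + ΣS[ f ∘ (inside ∷_) ]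
ΣS-cons {n} f = trans (sum-++ (map (outside ∷_) (subsets n)) _ f)
  (cong₂ _+_ (sum-map (subsets n) (outside ∷_) f) (sum-map (subsets n) (inside ∷_) f))

ΣS-delta : ∀ {n} (f : Subset n → ℚ) B → (∀ C → ¬ C ≡ B → f C ≡ 0ℚ) → ΣS[ f ] ≡ f B
ΣS-delta {zero}  f []            off = +-identityʳ (f [])
ΣS-delta {suc n} f (outside ∷ B) off = trans (ΣS-cons f)
  (trans (cong₂ _+_ (ΣS-delta (f ∘ (outside ∷_)) B (λ C C≢B → off _ (C≢B ∘ cong tail)))
                    (trans (sum-cong (subsets n) (λ C → off _ (λ ()))) (sum-zero (subsets n))))
         (+-identityʳ _))
ΣS-delta {suc n} f (inside ∷ B)  off = trans (ΣS-cons f)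
  (trans (cong₂ _+_ (trans (sum-cong (subsets n) (λ C → off _ (λ ()))) (sum-zero (subsets n)))
                    (ΣS-delta (f ∘ (inside ∷_)) B (λ C C≢B → off _ (C≢B ∘ cong tail))))
         (+-identityˡ _))

∈-subsets : ∀ {n} (B : Subset n) → B ∈ₗ subsets n
∈-subsets []            = here refl
∈-subsets (outside ∷ B) = ∈-++⁺ˡ (∈-map⁺ (outside ∷_) (∈-subsets B))
∈-subsets {suc n} (inside ∷ B) = ∈-++⁺ʳ (map (outside ∷_) (subsets n)) (∈-map⁺ (inside ∷_) (∈-subsets B))

-- Subsets, indicators and weights of subsets

indicator-∈ : ∀ {A : Subset n} {x} → x ∈ A → indicator A x ≡ 1ℚ
indicator-∈ here          = refl
indicator-∈ (there x∈A)   = indicator-∈ x∈A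

indicator-∉ : ∀ {A : Subset n} {x} → x ∉ A → indicator A x ≡ 0ℚ
indicator-∉ {A = outside ∷ A} {zero}  x∉A = refl
indicator-∉ {A = inside ∷ A}  {zero}  x∉A = ⊥-elim (x∉A here)
indicator-∉ {A = b ∷ A}       {suc x} x∉A = indicator-∉ (x∉A ∘ there)

0≤indicator : ∀ (A : Subset n) x → 0ℚ ≤ indicator A x
0≤indicator A x with lookup A x
... | true  = <⇒≤ (positive⁻¹ 1ℚ)
... | false = ≤-refl

indicator-∩ : ∀ (A B : Subset n) x → indicator (A ∩ B) x ≡ indicator A x * indicator B x
indicator-∩ (inside ∷ A)  (inside ∷ B)  zero    = refl
indicator-∩ (inside ∷ A)  (outside ∷ B) zero    = refl
indicator-∩ (outside ∷ A) (inside ∷ B)  zero    = refl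
indicator-∩ (outside ∷ A) (outside ∷ B) zero    = refl
indicator-∩ (_ ∷ A)       (_ ∷ B)       (suc x) = indicator-∩ A B x

if-lookup : ∀ (A : Subset n) x (v : ℚ) → (if lookup A x then v else 0ℚ) ≡ indicator A x * v
if-lookup A x v with lookup A x
... | true  = sym (*-identityˡ v)
... | false = sym (*-zeroˡ v)

card≡Σindicator : ∀ {n} (A : Subset n) → fromℕ ∣ A ∣ ≡ Σ[ indicator A ]
card≡Σindicator []           = refl
card≡Σindicator (inside ∷ A)  = trans (fromℕ-suc ∣ A ∣) (trans (cong (1ℚ +_) (card≡Σindicator A)) (sym (Σ-suc (indicator (inside ∷ A)))))
card≡Σindicator (outside ∷ A) = trans (card≡Σindicator A) (trans (sym (+-identityˡ _)) (sym (Σ-suc (indicator (outside ∷ A)))))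

∣p∣≡∣p∩q∣+∣p∩∁q∣ : ∀ {n} (p q : Subset n) → ∣ p ∣ ≡ ∣ p ∩ q ∣ ℕ.+ ∣ p ∩ ∁ q ∣
∣p∣≡∣p∩q∣+∣p∩∁q∣ []            []            = refl
∣p∣≡∣p∩q∣+∣p∩∁q∣ (outside ∷ p) (_ ∷ q)       = ∣p∣≡∣p∩q∣+∣p∩∁q∣ p q
∣p∣≡∣p∩q∣+∣p∩∁q∣ (inside ∷ p)  (inside ∷ q)  = cong suc (∣p∣≡∣p∩q∣+∣p∩∁q∣ p q)
∣p∣≡∣p∩q∣+∣p∩∁q∣ (inside ∷ p)  (outside ∷ q) =
  trans (cong suc (∣p∣≡∣p∩q∣+∣p∩∁q∣ p q)) (sym (ℕ.+-suc ∣ p ∩ q ∣ ∣ p ∩ ∁ q ∣))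

∣p∪⁅x⁆∣≡1+∣p∣ : ∀ {n} {p : Subset n} {x} → x ∉ p → ∣ p ∪ ⁅ x ⁆ ∣ ≡ suc ∣ p ∣
∣p∪⁅x⁆∣≡1+∣p∣ {p = outside ∷ p} {zero}  x∉p = cong (suc ∘ ∣_∣) (∪-identityʳ p)
∣p∪⁅x⁆∣≡1+∣p∣ {p = inside ∷ p}  {zero}  x∉p = ⊥-elim (x∉p here)
∣p∪⁅x⁆∣≡1+∣p∣ {p = outside ∷ p} {suc x} x∉p = ∣p∪⁅x⁆∣≡1+∣p∣ (x∉p ∘ there)
∣p∪⁅x⁆∣≡1+∣p∣ {p = inside ∷ p}  {suc x} x∉p = cong suc (∣p∪⁅x⁆∣≡1+∣p∣ (x∉p ∘ there))

x∈p⇒0<∣p∣ : ∀ {p : Subset n} {x} → x ∈ p → 0 ℕ.< ∣ p ∣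
x∈p⇒0<∣p∣ here               = ℕ.s≤s ℕ.z≤n
x∈p⇒0<∣p∣ {p = b ∷ p} (there x∈p) = ℕ.<-≤-trans (x∈p⇒0<∣p∣ x∈p) (∣p∣≤∣x∷p∣ b p)

∪-lub : ∀ {n} {p q s : Subset n} → p ⊆ s → q ⊆ s → p ∪ q ⊆ s
∪-lub {p = p} {q} p⊆s q⊆s x∈p∪q with x∈p∪q⁻ p q x∈p∪q
... | inj₁ x∈p = p⊆s x∈p
... | inj₂ x∈q = q⊆s x∈q

x∈p⇒⁅x⁆⊆p : ∀ {n} {x : Fin n} {p} → x ∈ p → ⁅ x ⁆ ⊆ p
x∈p⇒⁅x⁆⊆p {x = x} {p} x∈p y∈⁅x⁆ = subst (_∈ p) (sym (x∈⁅y⁆⇒x≡y x y∈⁅x⁆)) x∈p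

measure-Σ : ∀ (w : Fin n → ℚ) A → measure w A ≡ Σ[ (λ e → indicator A e * w e) ]
measure-Σ {n} w A = sum-cong (allFin n) (λ e → if-lookup A e (w e))

measure-cons : ∀ (w : Fin (suc n) → ℚ) b A → measure w (b ∷ A) ≡ (if b then w zero else 0ℚ) + measure (w ∘ suc) A
measure-cons w b A = Σ-suc (λ e → if lookup (b ∷ A) e then w e else 0ℚ)

measure-indicator : ∀ (A B : Subset n) → measure (indicator B) A ≡ fromℕ ∣ A ∩ B ∣
measure-indicator {n} A B = begin
  measure (indicator B) A                      ≡⟨ measure-Σ (indicator B) A ⟩
  Σ[ (λ e → indicator A e * indicator B e) ]   ≡⟨ sum-cong (allFin n) (λ e → sym (indicator-∩ A B e)) ⟩
  Σ[ indicator (A ∩ B) ]                       ≡⟨ sym (card≡Σindicator (A ∩ B)) ⟩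
  fromℕ ∣ A ∩ B ∣                              ∎
  where open ≡-Reasoning

measure-⁅⁆ : ∀ (w : Fin n → ℚ) x → measure w ⁅ x ⁆ ≡ w x
measure-⁅⁆ w x = begin
  measure w ⁅ x ⁆                          ≡⟨ measure-Σ w ⁅ x ⁆ ⟩
  Σ[ (λ e → indicator ⁅ x ⁆ e * w e) ]     ≡⟨ Σ-delta _ x (λ e e≢x → trans (cong (_* w e) (indicator-∉ (x≢y⇒x∉⁅y⁆ e≢x))) (*-zeroˡ (w e))) ⟩
  indicator ⁅ x ⁆ x * w x                  ≡⟨ trans (cong (_* w x) (indicator-∈ (x∈⁅x⁆ x))) (*-identityˡ (w x)) ⟩
  w x                                      ∎
  where open ≡-Reasoning

measure-const : ∀ (w : Fin n → ℚ) A c → (∀ {e} → e ∈ A → w e ≡ c) → measure w A ≡ c * fromℕ ∣ A ∣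
measure-const {n} w A c w≡c = begin
  measure w A                        ≡⟨ measure-Σ w A ⟩
  Σ[ (λ e → indicator A e * w e) ]   ≡⟨ sum-cong (allFin n) pointwise ⟩
  Σ[ (λ e → c * indicator A e) ]     ≡⟨ sum-*ˡ (allFin n) c (indicator A) ⟩
  c * Σ[ indicator A ]               ≡⟨ cong (c *_) (sym (card≡Σindicator A)) ⟩
  c * fromℕ ∣ A ∣                    ∎
  where
  open ≡-Reasoning
  pointwise : ∀ e → indicator A e * w e ≡ c * indicator A e
  pointwise e with e ∈? A
  ... | yes e∈A = trans (cong₂ _*_ (indicator-∈ e∈A) (w≡c e∈A))
                   (trans (*-identityˡ c) (sym (trans (cong (c *_) (indicator-∈ e∈A)) (*-identityʳ c))))
  ... | no  e∉A = trans (cong (_* w e) (indicator-∉ e∉A)) (trans (*-zeroˡ (w e)) (sym (trans (cong (c *_) (indicator-∉ e∉A)) (*-zeroʳ c))))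

measure-≤-const : ∀ (w : Fin n → ℚ) A c → (∀ e → w e ≤ c) → measure w A ≤ c * fromℕ ∣ A ∣
measure-≤-const {n} w A c w≤c = begin
  measure w A                        ≡⟨ measure-Σ w A ⟩
  Σ[ (λ e → indicator A e * w e) ]   ≤⟨ sum-mono-≤ (allFin n)
                                        (λ e → *-monoˡ-≤-nonNeg (indicator A e) {{nonNegative (0≤indicator A e)}} (w≤c e)) ⟩
  Σ[ (λ e → indicator A e * c) ]     ≡⟨ sum-cong (allFin n) (λ e → *-comm (indicator A e) c) ⟩
  Σ[ (λ e → c * indicator A e) ]     ≡⟨ sum-*ˡ (allFin n) c (indicator A) ⟩
  c * Σ[ indicator A ]               ≡⟨ cong (c *_) (sym (card≡Σindicator A)) ⟩
  c * fromℕ ∣ A ∣                    ∎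
  where open ≤-Reasoning

measure-complement : ∀ (w : Fin n → ℚ) A c → measure (λ e → c - w e) A ≡ c * fromℕ ∣ A ∣ - measure w A
measure-complement {n} w A c = begin
  measure (λ e → c - w e) A                                         ≡⟨ measure-Σ (λ e → c - w e) A ⟩
  Σ[ (λ e → indicator A e * (c - w e)) ]                            ≡⟨ sum-cong (allFin n)
                                                                       (λ e → solve 3 (λ i c w → i :* (c :- w) := c :* i :- i :* w) refl
                                                                       (indicator A e) c (w e)) ⟩
  Σ[ (λ e → c * indicator A e - indicator A e * w e) ]              ≡⟨ sum-- (allFin n) (λ e → c * indicator A e)
                                                                       (λ e → indicator A e * w e) ⟩
  Σ[ (λ e → c * indicator A e) ] - Σ[ (λ e → indicator A e * w e) ] ≡⟨ cong₂ _-_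
                                                                       (trans (sum-*ˡ (allFin n) c (indicator A))
                                                                       (cong (c *_) (sym (card≡Σindicator A)))) (sym (measure-Σ w A)) ⟩
  c * fromℕ ∣ A ∣ - measure w A                                     ∎
  where open ≡-Reasoning

measure-∪-⁅⁆ : ∀ (w : Fin n → ℚ) {A x} → x ∉ A → measure w (A ∪ ⁅ x ⁆) ≡ measure w A + w x
measure-∪-⁅⁆ w {A = outside ∷ A} {zero} x∉A = begin
  measure w (inside ∷ (A ∪ ⊥))         ≡⟨ measure-cons w inside (A ∪ ⊥) ⟩
  w zero + measure (w ∘ suc) (A ∪ ⊥)   ≡⟨ cong (λ B → w zero + measure (w ∘ suc) B) (∪-identityʳ A) ⟩
  w zero + measure (w ∘ suc) A         ≡⟨ solve 2 (λ a m → a :+ m := (con 0ℚ :+ m) :+ a) refl (w zero) (measure (w ∘ suc) A) ⟩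
  (0ℚ + measure (w ∘ suc) A) + w zero  ≡⟨ cong (_+ w zero) (sym (measure-cons w outside A)) ⟩
  measure w (outside ∷ A) + w zero     ∎
  where open ≡-Reasoning
measure-∪-⁅⁆ w {A = inside ∷ A} {zero} x∉A = ⊥-elim (x∉A here)
measure-∪-⁅⁆ w {A = b ∷ A} {suc x} x∉A = begin
  measure w ((b ∷ A) ∪ ⁅ suc x ⁆)                                    ≡⟨ measure-cons w (b ∨ false) (A ∪ ⁅ x ⁆) ⟩
  (if b ∨ false then w zero else 0ℚ) + measure (w ∘ suc) (A ∪ ⁅ x ⁆) ≡⟨ cong₂ _+_ (cong (λ c → if c then w zero else 0ℚ) (∨-identityʳ b))
                                                                        (measure-∪-⁅⁆ (w ∘ suc) (x∉A ∘ there)) ⟩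
  (if b then w zero else 0ℚ) + (measure (w ∘ suc) A + w (suc x))     ≡⟨ sym
                                                                        (+-assoc (if b then w zero else 0ℚ) (measure (w ∘ suc) A)
                                                                        (w (suc x))) ⟩
  (if b then w zero else 0ℚ) + measure (w ∘ suc) A + w (suc x)       ≡⟨ cong (_+ w (suc x)) (sym (measure-cons w b A)) ⟩
  measure w (b ∷ A) + w (suc x)                                      ∎
  where open ≡-Reasoning

measure-∩∁ : ∀ (w : Fin n → ℚ) A X → (∀ {e} → e ∈ X → w e ≡ 0ℚ) → measure w A ≡ measure w (A ∩ ∁ X)
measure-∩∁ w []      []      w≡0 = refl
measure-∩∁ w (a ∷ A) (x ∷ X) w≡0 = begin
  measure w (a ∷ A)                                                    ≡⟨ measure-cons w a A ⟩
  (if a then w zero else 0ℚ) + measure (w ∘ suc) A                     ≡⟨ cong₂ _+_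
                                                                          (first-term a x
                                                                          (λ x≡true → w≡0 (subst (λ b → zero ∈ b ∷ X) (sym x≡true) here)))
                                                                          (measure-∩∁ (w ∘ suc) A X (w≡0 ∘ there)) ⟩
  (if a ∧ not x then w zero else 0ℚ) + measure (w ∘ suc) (A ∩ ∁ X)     ≡⟨ sym (measure-cons w (a ∧ not x) (A ∩ ∁ X)) ⟩
  measure w ((a ∷ A) ∩ ∁ (x ∷ X))                                      ∎
  where
  open ≡-Reasoning
  first-term : ∀ a x → (x ≡ true → w zero ≡ 0ℚ) → (if a then w zero else 0ℚ) ≡ (if a ∧ not x then w zero else 0ℚ)
  first-term false x     _   = refl
  first-term true  false _   = refl
  first-term true  true  w≡0 = w≡0 refl

measure-mono-⊆ : ∀ (w : Fin n → ℚ) {A B} → (∀ e → 0ℚ ≤ w e) → A ⊆ B → measure w A ≤ measure w B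
measure-mono-⊆ w {[]}    {[]}    0≤w A⊆B = ≤-refl
measure-mono-⊆ w {a ∷ A} {b ∷ B} 0≤w A⊆B = begin
  measure w (a ∷ A)                                   ≡⟨ measure-cons w a A ⟩
  (if a then w zero else 0ℚ) + measure (w ∘ suc) A    ≤⟨ +-mono-≤ (first-term a b (λ a≡true → A⊆B (subst (λ c → zero ∈ c ∷ A) (sym a≡true) here)))
                                                         (measure-mono-⊆ (w ∘ suc) (0≤w ∘ suc) (drop-∷-⊆ A⊆B)) ⟩
  (if b then w zero else 0ℚ) + measure (w ∘ suc) B    ≡⟨ sym (measure-cons w b B) ⟩
  measure w (b ∷ B)                                   ∎
  where
  open ≤-Reasoning
  first-term : ∀ a b → (a ≡ true → zero ∈ b ∷ B) → (if a then w zero else 0ℚ) ≤ (if b then w zero else 0ℚ)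
  first-term false false _ = ≤-refl
  first-term false true  _ = 0≤w zero
  first-term true  true  _ = ≤-refl
  first-term true  false 0∈B with () ← 0∈B refl

dot-indicator-difference : ∀ (w : Fin n → ℚ) A B → dot w (λ e → indicator A e - indicator B e) ≡ measure w A - measure w B
dot-indicator-difference {n} w A B = begin
  Σ[ (λ e → w e * (indicator A e - indicator B e)) ]                    ≡⟨ sum-cong (allFin n)
                                                                           (λ e → solve 3 (λ w a b → w :* (a :- b) := a :* w :- b :* w) refl
                                                                           (w e) (indicator A e) (indicator B e)) ⟩
  Σ[ (λ e → indicator A e * w e - indicator B e * w e) ]                ≡⟨ sum-- (allFin n) _ _ ⟩
  Σ[ (λ e → indicator A e * w e) ] - Σ[ (λ e → indicator B e * w e) ]   ≡⟨ sym (cong₂ _-_ (measure-Σ w A) (measure-Σ w B)) ⟩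
  measure w A - measure w B                                             ∎
  where open ≡-Reasoning

-- Maxima and minima

module _ {A : Set} (f : A → ℕ) where

  ≤-foldr-⊔ : ∀ {xs x} → x ∈ₗ xs → f x ℕ.≤ foldr ℕ._⊔_ 0 (map f xs)
  ≤-foldr-⊔ {y ∷ xs} (here refl)  = ℕ.m≤m⊔n (f y) _
  ≤-foldr-⊔ {y ∷ xs} (there x∈xs) = ℕ.≤-trans (≤-foldr-⊔ x∈xs) (ℕ.m≤n⊔m (f y) _)

  foldr-⊔-attained : ∀ xs → foldr ℕ._⊔_ 0 (map f xs) ≡ 0 ⊎ ∃[ x ] (x ∈ₗ xs × f x ≡ foldr ℕ._⊔_ 0 (map f xs))
  foldr-⊔-attained []       = inj₁ refl
  foldr-⊔-attained (y ∷ xs) with ℕ.⊔-sel (f y) (foldr ℕ._⊔_ 0 (map f xs)) | foldr-⊔-attained xs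
  ... | inj₁ max≡fy   | _                  = inj₂ (y , here refl , sym max≡fy)
  ... | inj₂ max≡rest | inj₁ rest≡0        = inj₁ (trans max≡rest rest≡0)
  ... | inj₂ max≡rest | inj₂ (x , x∈xs , fx≡rest) = inj₂ (x , there x∈xs , trans fx≡rest (sym max≡rest))

module _ {A : Set} (f : A → ℚ) where

  ≤-foldr-⊔ℚ : ∀ {xs x} → x ∈ₗ xs → f x ≤ foldr _⊔_ 0ℚ (map f xs)
  ≤-foldr-⊔ℚ {y ∷ xs} (here refl)  = p≤p⊔q (f y) _
  ≤-foldr-⊔ℚ {y ∷ xs} (there x∈xs) = ≤-trans (≤-foldr-⊔ℚ x∈xs) (p≤q⊔p (f y) _)

  foldr-⊔ℚ-attained : ∀ xs → foldr _⊔_ 0ℚ (map f xs) ≡ 0ℚ ⊎ ∃[ x ] f x ≡ foldr _⊔_ 0ℚ (map f xs)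
  foldr-⊔ℚ-attained []       = inj₁ refl
  foldr-⊔ℚ-attained (y ∷ xs) with ⊔-sel (f y) (foldr _⊔_ 0ℚ (map f xs)) | foldr-⊔ℚ-attained xs
  ... | inj₁ max≡fy   | _                   = inj₂ (y , sym max≡fy)
  ... | inj₂ max≡rest | inj₁ rest≡0         = inj₁ (trans max≡rest rest≡0)
  ... | inj₂ max≡rest | inj₂ (x , fx≡rest)  = inj₂ (x , trans fx≡rest (sym max≡rest))

  foldr-⊓-≤ : ∀ {seed xs x} → x ∈ₗ xs → foldr _⊓_ seed (map f xs) ≤ f x
  foldr-⊓-≤ {xs = y ∷ xs} (here refl)  = p⊓q≤p (f y) _
  foldr-⊓-≤ {xs = y ∷ xs} (there x∈xs) = ≤-trans (p⊓q≤q (f y) _) (foldr-⊓-≤ x∈xs)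

  ≤-foldr-⊓ : ∀ {s seed} xs → s ≤ seed → (∀ {x} → x ∈ₗ xs → s ≤ f x) → s ≤ foldr _⊓_ seed (map f xs)
  ≤-foldr-⊓ []       s≤seed s≤f = s≤seed
  ≤-foldr-⊓ (y ∷ xs) s≤seed s≤f = ⊓-glb (s≤f (here refl)) (≤-foldr-⊓ xs s≤seed (s≤f ∘ there))

module _ {n : ℕ} (w : Fin n → ℚ) where

  ≤-maxℚ : ∀ e → w e ≤ maxℚ w
  ≤-maxℚ e = ≤-foldr-⊔ℚ w (∈-allFin e)

  lookup-argmax : ∀ e → lookup (argmaxSet w) e ≡ ⌊ w e ≟ maxℚ w ⌋
  lookup-argmax e = Vec.lookup∘tabulate _ e

  ∈-argmax⇒≡max : ∀ {e} → e ∈ argmaxSet w → w e ≡ maxℚ w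
  ∈-argmax⇒≡max {e} e∈X = ⌊⌋-true⁻ (w e ≟ maxℚ w) (trans (sym (lookup-argmax e)) (Vec.[]=⇒lookup e∈X))

  ∉-argmax⇒<max : ∀ {e} → e ∉ argmaxSet w → w e < maxℚ w
  ∉-argmax⇒<max {e} e∉X = ≤∧≢⇒< (≤-maxℚ e) (λ we≡max → e∉X (Vec.lookup⇒[]= e _ (trans (lookup-argmax e) (⌊⌋-true (w e ≟ maxℚ w) we≡max))))

  argmax-nonempty : 0ℚ < maxℚ w → ∃[ e ] e ∈ argmaxSet w
  argmax-nonempty 0<max with foldr-⊔ℚ-attained w (allFin n)
  ... | inj₁ max≡0 = ⊥-elim (<-irrefl (sym max≡0) 0<max)
  ... | inj₂ (e , we≡max) = e , Vec.lookup⇒[]= e _ (trans (lookup-argmax e) (⌊⌋-true (w e ≟ maxℚ w) we≡max))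

-- Matroids

module MatroidProperties {n : ℕ} (M : Matroid n) where

  open Matroid M

  r : Subset n → ℕ
  r = rank M

  independentSubsets : Subset n → List (Subset n)
  independentSubsets A = filter (_⊆? A) (filter (λ Y → indep Y Bool.≟ true) (subsets n))

  indep⊆⇒∣∣≤rank : ∀ {I A} → indep I ≡ true → I ⊆ A → ∣ I ∣ ℕ.≤ r A
  indep⊆⇒∣∣≤rank {I} {A} I-indep I⊆A =
    ≤-foldr-⊔ ∣_∣ (∈-filter⁺ (_⊆? A) (∈-filter⁺ (λ Y → indep Y Bool.≟ true) (∈-subsets I) I-indep) I⊆A)

  rank-witness : ∀ A → ∃[ I ] (indep I ≡ true × I ⊆ A × ∣ I ∣ ≡ r A)
  rank-witness A with foldr-⊔-attained ∣_∣ (independentSubsets A)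
  ... | inj₁ rA≡0 = ⊥ , indep-∅ , (λ x∈⊥ → ⊥-elim (∉⊥ x∈⊥)) , trans (∣⊥∣≡0 n) (sym rA≡0)
  ... | inj₂ (I , I∈ , ∣I∣≡rA) with ∈-filter⁻ (_⊆? A) {xs = filter (λ Y → indep Y Bool.≟ true) (subsets n)} I∈
  ...   | I∈′ , I⊆A = I , proj₂ (∈-filter⁻ (λ Y → indep Y Bool.≟ true) {xs = subsets n} I∈′) , I⊆A , ∣I∣≡rA

  rank-mono : ∀ {A B} → A ⊆ B → r A ℕ.≤ r B
  rank-mono {A} A⊆B with rank-witness A
  ... | I , I-indep , I⊆A , ∣I∣≡rA = subst (ℕ._≤ _) ∣I∣≡rA (indep⊆⇒∣∣≤rank I-indep (A⊆B ∘ I⊆A))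

  rank≤rank⊤ : ∀ A → r A ℕ.≤ r ⊤
  rank≤rank⊤ A = rank-mono (⊆⊤ {p = A})

  rank-∪-⁅⁆ : ∀ A e → r (A ∪ ⁅ e ⁆) ℕ.≤ suc (r A)
  rank-∪-⁅⁆ A e with rank-witness (A ∪ ⁅ e ⁆)
  ... | I , I-indep , I⊆A∪e , ∣I∣≡r = begin
    r (A ∪ ⁅ e ⁆)               ≡⟨ sym ∣I∣≡r ⟩
    ∣ I ∣                       ≡⟨ ∣p∣≡∣p∩q∣+∣p∩∁q∣ I A ⟩
    ∣ I ∩ A ∣ ℕ.+ ∣ I ∩ ∁ A ∣   ≤⟨ ℕ.+-mono-≤ (indep⊆⇒∣∣≤rank (indep-↓ (p∩q⊆p I A) I-indep) (p∩q⊆q I A)) outside-A ⟩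
    r A ℕ.+ 1                   ≡⟨ ℕ.+-comm (r A) 1 ⟩
    suc (r A)                   ∎
    where
    open ℕ.≤-Reasoning
    I∖A⊆⁅e⁆ : I ∩ ∁ A ⊆ ⁅ e ⁆
    I∖A⊆⁅e⁆ x∈I∖A with x∈p∩q⁻ I (∁ A) x∈I∖A
    ... | x∈I , x∈∁A with x∈p∪q⁻ A ⁅ e ⁆ (I⊆A∪e x∈I)
    ...   | inj₁ x∈A = ⊥-elim (x∈∁p⇒x∉p x∈∁A x∈A)
    ...   | inj₂ x∈e = x∈e
    outside-A : ∣ I ∩ ∁ A ∣ ℕ.≤ 1
    outside-A = ℕ.≤-trans (p⊆q⇒∣p∣≤∣q∣ I∖A⊆⁅e⁆) (ℕ.≤-reflexive (∣⁅x⁆∣≡1 e))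

  augment-within : ∀ {I A} → indep I ≡ true → ∣ I ∣ ℕ.< r A → ∃[ f ] (f ∈ A × f ∉ I × indep (I ∪ ⁅ f ⁆) ≡ true)
  augment-within {I} {A} I-indep ∣I∣<rA with rank-witness A
  ... | J , J-indep , J⊆A , ∣J∣≡rA with indep-aug I-indep J-indep (subst (∣ I ∣ ℕ.<_) (sym ∣J∣≡rA) ∣I∣<rA)
  ...   | f , f∈J , f∉I , I+f-indep = f , J⊆A f∈J , f∉I , I+f-indep

  base-card : ∀ {B} → IsBase indep B → ∣ B ∣ ≡ r ⊤
  base-card {B} (B-indep , B-maximal) with ℕ.<-≤-connex ∣ B ∣ (r ⊤)
  ... | inj₂ r⊤≤∣B∣ = ℕ.≤-antisym (indep⊆⇒∣∣≤rank B-indep ⊆⊤) r⊤≤∣B∣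
  ... | inj₁ ∣B∣<r⊤ with augment-within B-indep ∣B∣<r⊤
  ...   | f , _ , f∉B , B+f-indep with () ← trans (sym B+f-indep) (B-maximal f f∉B)

  full-rank⇒base : ∀ {B} → indep B ≡ true → ∣ B ∣ ≡ r ⊤ → IsBase indep B
  full-rank⇒base {B} B-indep ∣B∣≡r⊤ = B-indep , maximal
    where
    maximal : ∀ e → e ∉ B → indep (B ∪ ⁅ e ⁆) ≡ false
    maximal e e∉B with indep (B ∪ ⁅ e ⁆) in B+e-indep
    ... | false = refl
    ... | true  = ⊥-elim (ℕ.<-irrefl refl (begin-strict
      r ⊤              ≡⟨ sym ∣B∣≡r⊤ ⟩
      ∣ B ∣            <⟨ ℕ.n<1+n ∣ B ∣ ⟩
      suc ∣ B ∣        ≡⟨ sym (∣p∪⁅x⁆∣≡1+∣p∣ e∉B) ⟩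
      ∣ B ∪ ⁅ e ⁆ ∣    ≤⟨ indep⊆⇒∣∣≤rank B+e-indep ⊆⊤ ⟩
      r ⊤              ∎))
      where open ℕ.≤-Reasoning

  extend-to-base : ∀ {I} → indep I ≡ true → ∃[ B ] (IsBase indep B × I ⊆ B)
  extend-to-base {I} I-indep = go (r ⊤ ∸ ∣ I ∣) I-indep (ℕ.m∸n+n≡m (indep⊆⇒∣∣≤rank I-indep ⊆⊤))
    where
    go : ∀ k {J} → indep J ≡ true → k ℕ.+ ∣ J ∣ ≡ r ⊤ → ∃[ B ] (IsBase indep B × J ⊆ B)
    go zero    J-indep ∣J∣≡r⊤ = _ , full-rank⇒base J-indep ∣J∣≡r⊤ , (λ x∈J → x∈J)
    go (suc k) {J} J-indep k+1+∣J∣≡r⊤ with augment-within J-indep (subst (∣ J ∣ ℕ.<_) k+1+∣J∣≡r⊤ (ℕ.m<n+m ∣ J ∣ (ℕ.s≤s ℕ.z≤n)))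
    ... | f , _ , f∉J , J+f-indep with go k J+f-indep (trans (cong (k ℕ.+_) (∣p∪⁅x⁆∣≡1+∣p∣ f∉J)) (trans (ℕ.+-suc k ∣ J ∣) k+1+∣J∣≡r⊤))
    ...   | B , B-base , J+f⊆B = B , B-base , J+f⊆B ∘ p⊆p∪q ⁅ f ⁆

  rank-increase : ∀ {A} → r A ℕ.< r ⊤ → ∃[ e ] (e ∉ A × r (A ∪ ⁅ e ⁆) ≡ suc (r A))
  rank-increase {A} rA<r⊤ with rank-witness A
  ... | I , I-indep , I⊆A , ∣I∣≡rA with augment-within I-indep (subst (ℕ._< r ⊤) (sym ∣I∣≡rA) rA<r⊤)
  ...   | e , _ , e∉I , I+e-indep = e , e∉A , ℕ.≤-antisym (rank-∪-⁅⁆ A e) (subst (ℕ._≤ r (A ∪ ⁅ e ⁆)) ∣I+e∣≡1+rA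
                                                       (indep⊆⇒∣∣≤rank I+e-indep (∪-lub (p⊆p∪q ⁅ e ⁆ ∘ I⊆A) (q⊆p∪q A ⁅ e ⁆))))
    where
    ∣I+e∣≡1+rA : ∣ I ∪ ⁅ e ⁆ ∣ ≡ suc (r A)
    ∣I+e∣≡1+rA = trans (∣p∪⁅x⁆∣≡1+∣p∣ e∉I) (cong suc ∣I∣≡rA)
    e∉A : e ∉ A
    e∉A e∈A = ℕ.<-irrefl refl (ℕ.≤-trans (ℕ.≤-reflexive (sym ∣I+e∣≡1+rA)) (indep⊆⇒∣∣≤rank I+e-indep (∪-lub I⊆A (x∈p⇒⁅x⁆⊆p e∈A))))

  closed-if-rank-jumps : ∀ Z → (∀ {y} → y ∉ Z → ¬ r (Z ∪ ⁅ y ⁆) ≡ r Z) → cl M Z ≡ Z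
  closed-if-rank-jumps Z jumps = ⊆-antisym cl⊆Z Z⊆cl
    where
    lookup-cl : ∀ y → lookup (cl M Z) y ≡ ⌊ r (Z ∪ ⁅ y ⁆) ℕ.≟ r Z ⌋
    lookup-cl y = Vec.lookup∘tabulate _ y
    Z⊆cl : Z ⊆ cl M Z
    Z⊆cl {y} y∈Z = Vec.lookup⇒[]= y (cl M Z) (trans (lookup-cl y) (⌊⌋-true (r (Z ∪ ⁅ y ⁆) ℕ.≟ r Z) (cong r Z∪y≡Z)))
      where
      Z∪y≡Z : Z ∪ ⁅ y ⁆ ≡ Z
      Z∪y≡Z = ⊆-antisym (∪-lub (λ x∈Z → x∈Z) (x∈p⇒⁅x⁆⊆p y∈Z)) (p⊆p∪q ⁅ y ⁆)
    cl⊆Z : cl M Z ⊆ Z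
    cl⊆Z {y} y∈cl with y ∈? Z
    ... | yes y∈Z = y∈Z
    ... | no  y∉Z with () ← trans (sym (Vec.[]=⇒lookup y∈cl)) (trans (lookup-cl y) (⌊⌋-false (r (Z ∪ ⁅ y ⁆) ℕ.≟ r Z) (jumps y∉Z)))

  isBase? : ∀ B → Dec (IsBase indep B)
  isBase? B = (indep B Bool.≟ true) ×-dec Fin.all? (λ e → ¬? (e ∈? B) →-dec (indep (B ∪ ⁅ e ⁆) Bool.≟ false))

  rank≤card : ∀ A → r A ℕ.≤ ∣ A ∣
  rank≤card A with rank-witness A
  ... | I , _ , I⊆A , ∣I∣≡rA = subst (ℕ._≤ ∣ A ∣) ∣I∣≡rA (p⊆q⇒∣p∣≤∣q∣ I⊆A)

  base-meets : ∀ {B} → IsBase indep B → ∀ A → r ⊤ ℕ.≤ ∣ A ∩ B ∣ ℕ.+ r (∁ A)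
  base-meets {B} B-base A = begin
    r ⊤                          ≡⟨ sym (base-card B-base) ⟩
    ∣ B ∣                        ≡⟨ ∣p∣≡∣p∩q∣+∣p∩∁q∣ B A ⟩
    ∣ B ∩ A ∣ ℕ.+ ∣ B ∩ ∁ A ∣    ≤⟨ ℕ.+-mono-≤ (ℕ.≤-reflexive (cong ∣_∣ (∩-comm B A)))
                                    (indep⊆⇒∣∣≤rank (indep-↓ (p∩q⊆p B (∁ A)) (proj₁ B-base)) (p∩q⊆q B (∁ A))) ⟩
    ∣ A ∩ B ∣ ℕ.+ r (∁ A)        ∎
    where open ℕ.≤-Reasoning

module _ {n : ℕ} (M : Matroid n) (w : Fin n → ℚ) where

  open Matroid M
  open MatroidProperties M

  private
    X : Subset n
    X = argmaxSet w

    c : ℚ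
    c = maxℚ w

    slack : Fin n → ℚ
    slack e = c - w e

    0≤slack : ∀ e → 0ℚ ≤ slack e
    0≤slack e = p≤q⇒0≤q-p (≤-maxℚ w e)

    slack-X : ∀ {e} → e ∈ X → slack e ≡ 0ℚ
    slack-X e∈X = trans (cong (λ x → c - x) (∈-argmax⇒≡max w e∈X)) (+-inverseʳ c)

    I-indep : ∀ {B} → IsBase indep B → indep (B ∩ ∁ X) ≡ true
    I-indep {B} B-base = indep-↓ (p∩q⊆p B (∁ X)) (proj₁ B-base)

    measure-via-slack : ∀ A → measure w A ≡ c * fromℕ ∣ A ∣ - measure slack A
    measure-via-slack A = begin
      measure w A               ≡⟨ solve 2 (λ m k → m := k :- (k :- m)) refl (measure w A) cA ⟩
      cA - (cA - measure w A)   ≡⟨ cong (λ x → cA - x) (sym (measure-complement w A c)) ⟩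
      cA - measure slack A      ∎
      where
      open ≡-Reasoning
      cA : ℚ
      cA = c * fromℕ ∣ A ∣

  minimum-base-spans-below-max : ∀ {B} → IsBase indep B → (∀ {B′} → IsBase indep B′ → measure w B ≤ measure w B′) →
                                  ∣ B ∩ ∁ (argmaxSet w) ∣ ≡ r (∁ (argmaxSet w))
  minimum-base-spans-below-max {B} B-base B-min with ℕ.<-≤-connex ∣ B ∩ ∁ X ∣ (r (∁ X))
  ... | inj₂ r≤∣I∣ = ℕ.≤-antisym (indep⊆⇒∣∣≤rank (I-indep B-base) (p∩q⊆q B (∁ X))) r≤∣I∣
  ... | inj₁ ∣I∣<r with augment-within (I-indep B-base) ∣I∣<r
  ...   | f , f∈∁X , f∉I , I+f-indep with extend-to-base I+f-indep
  ...     | B′ , B′-base , I+f⊆B′ = ⊥-elim (<-irrefl refl (<-≤-trans B′<B (B-min B′-base)))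
    where
    I : Subset n
    I = B ∩ ∁ X
    slack-B<slack-B′ : measure slack B < measure slack B′
    slack-B<slack-B′ = begin-strict
      measure slack B                  ≡⟨ measure-∩∁ slack B X slack-X ⟩
      measure slack I                  <⟨ subst (_< measure slack I + slack f) (+-identityʳ (measure slack I))
                                          (+-monoʳ-< (measure slack I) (p<q⇒0<q-p (∉-argmax⇒<max w (x∈∁p⇒x∉p f∈∁X)))) ⟩
      measure slack I + slack f        ≡⟨ sym (measure-∪-⁅⁆ slack f∉I) ⟩
      measure slack (I ∪ ⁅ f ⁆)        ≤⟨ measure-mono-⊆ slack 0≤slack I+f⊆B′ ⟩
      measure slack B′                 ∎
      where open ≤-Reasoning
    B′<B : measure w B′ < measure w B
    B′<B = begin-strict
      measure w B′                                  ≡⟨ measure-via-slack B′ ⟩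
      c * (fromℕ ∣ B′ ∣) - measure slack B′         ≡⟨ cong (λ k → c * fromℕ k - measure slack B′)
                                                       (trans (base-card B′-base) (sym (base-card B-base))) ⟩
      c * (fromℕ ∣ B ∣) - measure slack B′          <⟨ +-monoʳ-< (c * fromℕ ∣ B ∣) (neg-antimono-< slack-B<slack-B′) ⟩
      c * (fromℕ ∣ B ∣) - measure slack B           ≡⟨ sym (measure-via-slack B) ⟩
      measure w B                                   ∎
      where open ≤-Reasoning

-- Edge usage and the MEO problem

module _ {n : ℕ} (μ : Subset n → ℚ) where

  edgeUsage-Σ : ∀ e → edgeUsage μ e ≡ ΣS[ (λ B → μ B * indicator B e) ]
  edgeUsage-Σ e = sum-cong (subsets n) (λ B → trans (if-lookup B e (μ B)) (*-comm (indicator B e) (μ B)))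

  edgeUsage≢0⇒∈support : ∀ {e} → ¬ edgeUsage μ e ≡ 0ℚ → ∃[ B ] (¬ μ B ≡ 0ℚ × e ∈ B)
  edgeUsage≢0⇒∈support {e} η≢0 with sum≢0⇒term≢0 (subsets n) _ (η≢0 ∘ trans (edgeUsage-Σ e))
  ... | B , term≢0 with e ∈? B
  ...   | yes e∈B = B , (λ μB≡0 → term≢0 (trans (cong (_* indicator B e) μB≡0) (*-zeroˡ (indicator B e)))) , e∈B
  ...   | no  e∉B = ⊥-elim (term≢0 (trans (cong (μ B *_) (indicator-∉ e∉B)) (*-zeroʳ (μ B))))

  sum-edgeUsage : ∀ {I : Set} (xs : List I) (a : I → ℚ) (φ : I → Fin n) →
                  sumOver xs (λ j → a j * edgeUsage μ (φ j)) ≡ ΣS[ (λ B → μ B * sumOver xs (λ j → a j * indicator B (φ j))) ]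
  sum-edgeUsage xs a φ = begin
    sumOver xs (λ j → a j * edgeUsage μ (φ j))                         ≡⟨ sum-cong xs
                                                                          (λ j → trans (cong (a j *_) (edgeUsage-Σ (φ j)))
                                                                          (sym (sum-*ˡ (subsets n) (a j) _))) ⟩
    sumOver xs (λ j → ΣS[ (λ B → a j * (μ B * indicator B (φ j))) ])   ≡⟨ sum-swap xs (subsets n) _ ⟩
    ΣS[ (λ B → sumOver xs (λ j → a j * (μ B * indicator B (φ j)))) ]   ≡⟨ sum-cong (subsets n)
                                                                          (λ B → trans
                                                                          (sum-cong xs (λ j → reorder (a j) (μ B) (indicator B (φ j))))
                                                                          (sum-*ˡ xs (μ B) _)) ⟩
    ΣS[ (λ B → μ B * sumOver xs (λ j → a j * indicator B (φ j))) ]     ∎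
    where
    open ≡-Reasoning
    reorder : ∀ a m i → a * (m * i) ≡ m * (a * i)
    reorder = solve 3 (λ a m i → a :* (m :* i) := m :* (a :* i)) refl

  measure-edgeUsage : ∀ A → measure (edgeUsage μ) A ≡ ΣS[ (λ B → μ B * fromℕ ∣ A ∩ B ∣) ]
  measure-edgeUsage A = begin
    measure (edgeUsage μ) A                                        ≡⟨ measure-Σ (edgeUsage μ) A ⟩
    Σ[ (λ e → indicator A e * edgeUsage μ e) ]                     ≡⟨ sum-edgeUsage (allFin n) (indicator A) (λ e → e) ⟩
    ΣS[ (λ B → μ B * Σ[ (λ e → indicator A e * indicator B e) ]) ] ≡⟨ sum-cong (subsets n)
                                                                      (λ B → cong (μ B *_)
                                                                      (trans (sym (measure-Σ (indicator B) A)) (measure-indicator A B))) ⟩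
    ΣS[ (λ B → μ B * fromℕ ∣ A ∩ B ∣) ]                            ∎
    where open ≡-Reasoning

  meoObj≡energy : meoObj μ ≡ energy (edgeUsage μ)
  meoObj≡energy = begin
    meoObj μ                                                          ≡⟨ sum-cong (subsets n)
                                                                         (λ B → trans (sum-cong (subsets n) (λ C → *-assoc (μ B) (μ C) _))
                                                                         (sum-*ˡ (subsets n) (μ B) _)) ⟩
    ΣS[ (λ B → μ B * ΣS[ (λ C → μ C * fromℕ ∣ B ∩ C ∣) ]) ]           ≡⟨ sum-cong (subsets n)
                                                                         (λ B → cong (μ B *_) (sym (measure-edgeUsage B))) ⟩
    ΣS[ (λ B → μ B * measure η B) ]                                   ≡⟨ sum-cong (subsets n)
                                                                         (λ B → cong (μ B *_)
                                                                         (trans (measure-Σ η B)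
                                                                         (sum-cong (allFin n) (λ e → *-comm (indicator B e) (η e))))) ⟩
    ΣS[ (λ B → μ B * Σ[ (λ e → η e * indicator B e) ]) ]              ≡⟨ sym (sum-edgeUsage (allFin n) η (λ e → e)) ⟩
    energy η                                                          ∎
    where
    open ≡-Reasoning
    η = edgeUsage μ

energy-shift : ∀ {n} (η d : Fin n → ℚ) δ → energy (λ e → η e + δ * d e) ≡ energy η + (δ + δ) * dot η d + δ * δ * energy d
energy-shift {n} η d δ = begin
  Σ[ (λ e → (η e + δ * d e) * (η e + δ * d e)) ]                                    ≡⟨ sum-cong (allFin n) (λ e → expand (η e) (d e)) ⟩
  Σ[ (λ e → η e * η e + (δ + δ) * (η e * d e) + δ * δ * (d e * d e)) ]              ≡⟨ sum-+ (allFin n) _ _ ⟩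
  Σ[ (λ e → η e * η e + (δ + δ) * (η e * d e)) ] + Σ[ (λ e → δ * δ * (d e * d e)) ] ≡⟨ cong₂ _+_
                                                                                       (trans (sum-+ (allFin n) _ _)
                                                                                       (cong (energy η +_) (sum-*ˡ (allFin n) (δ + δ) _)))
                                                                                       (sum-*ˡ (allFin n) (δ * δ) _) ⟩
  energy η + (δ + δ) * dot η d + δ * δ * energy d                                   ∎
  where
  open ≡-Reasoning
  expand : ∀ x y → (x + δ * y) * (x + δ * y) ≡ x * x + (δ + δ) * (x * y) + δ * δ * (y * y)
  expand x y = solve 3 (λ x y δ → (x :+ δ :* y) :* (x :+ δ :* y) := x :* x :+ (δ :+ δ) :* (x :* y) :+ δ :* δ :* (y :* y)) refl x y δ

module _ {n : ℕ} {ind : Subset n → Bool} {μ : Subset n → ℚ} (μ-pmf : IsPMF ind μ) where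

  private
    0≤μ : ∀ B → 0ℚ ≤ μ B
    0≤μ = proj₁ μ-pmf

    Σμ≡1 : ΣS[ μ ] ≡ 1ℚ
    Σμ≡1 = proj₂ (proj₂ μ-pmf)

  support-average-≥ : ∀ c (f : Subset n → ℚ) → (∀ B → ¬ μ B ≡ 0ℚ → c ≤ f B) → c ≤ ΣS[ (λ B → μ B * f B) ]
  support-average-≥ c f c≤f = begin
    c                          ≡⟨ sym
                                  (trans (sum-cong (subsets n) (λ B → *-comm (μ B) c))
                                  (trans (sum-*ˡ (subsets n) c μ) (trans (cong (c *_) Σμ≡1) (*-identityʳ c)))) ⟩
    ΣS[ (λ B → μ B * c) ]      ≤⟨ sum-mono-≤ (subsets n) pointwise ⟩
    ΣS[ (λ B → μ B * f B) ]    ∎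
    where
    open ≤-Reasoning
    pointwise : ∀ B → μ B * c ≤ μ B * f B
    pointwise B with μ B ≟ 0ℚ
    ... | yes μB≡0 = ≤-reflexive (trans (cong (_* c) μB≡0) (trans (*-zeroˡ c) (sym (trans (cong (_* f B) μB≡0) (*-zeroˡ (f B))))))
    ... | no  μB≢0 = *-monoˡ-≤-nonNeg (μ B) {{nonNegative (0≤μ B)}} (c≤f B μB≢0)

  support-average-≡ : ∀ c (f : Subset n → ℚ) → (∀ B → ¬ μ B ≡ 0ℚ → f B ≡ c) → ΣS[ (λ B → μ B * f B) ] ≡ c
  support-average-≡ c f f≡c = begin
    ΣS[ (λ B → μ B * f B) ]    ≡⟨ sum-cong (subsets n) pointwise ⟩
    ΣS[ (λ B → c * μ B) ]      ≡⟨ sum-*ˡ (subsets n) c μ ⟩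
    c * ΣS[ μ ]                ≡⟨ trans (cong (c *_) Σμ≡1) (*-identityʳ c) ⟩
    c                          ∎
    where
    open ≡-Reasoning
    pointwise : ∀ B → μ B * f B ≡ c * μ B
    pointwise B with μ B ≟ 0ℚ
    ... | yes μB≡0 = trans (cong (_* f B) μB≡0) (trans (*-zeroˡ (f B)) (sym (trans (cong (c *_) μB≡0) (*-zeroʳ c))))
    ... | no  μB≢0 = trans (cong (μ B *_) (f≡c B μB≢0)) (*-comm (μ B) c)

module _ {n : ℕ} where

  pointMass : Subset n → Subset n → ℚ
  pointMass B C = if ⌊ Vec.≡-dec Bool._≟_ C B ⌋ then 1ℚ else 0ℚ

  pointMass-other : ∀ {B C} → ¬ C ≡ B → pointMass B C ≡ 0ℚ
  pointMass-other {B} {C} C≢B = cong (if_then 1ℚ else 0ℚ) (⌊⌋-false (Vec.≡-dec Bool._≟_ C B) C≢B)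

  pointMass-self : ∀ B → pointMass B B ≡ 1ℚ
  pointMass-self B = cong (if_then 1ℚ else 0ℚ) (⌊⌋-true (Vec.≡-dec Bool._≟_ B B) refl)

  0≤pointMass : ∀ B C → 0ℚ ≤ pointMass B C
  0≤pointMass B C with ⌊ Vec.≡-dec Bool._≟_ C B ⌋
  ... | true  = <⇒≤ (positive⁻¹ 1ℚ)
  ... | false = ≤-refl

  ΣS-pointMass : ∀ B (f : Subset n → ℚ) → ΣS[ (λ C → pointMass B C * f C) ] ≡ f B
  ΣS-pointMass B f = trans (ΣS-delta _ B (λ C C≢B → trans (cong (_* f C) (pointMass-other C≢B)) (*-zeroˡ (f C))))
                           (trans (cong (_* f B) (pointMass-self B)) (*-identityˡ (f B)))

  transfer : (Subset n → ℚ) → Subset n → Subset n → ℚ → Subset n → ℚ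
  transfer μ B B′ δ C = μ C + δ * (pointMass B′ C - pointMass B C)

  ΣS-transfer : ∀ μ B B′ δ (f : Subset n → ℚ) →
                ΣS[ (λ C → transfer μ B B′ δ C * f C) ] ≡ ΣS[ (λ C → μ C * f C) ] + δ * (f B′ - f B)
  ΣS-transfer μ B B′ δ f = begin
    ΣS[ (λ C → transfer μ B B′ δ C * f C) ]                                                                ≡⟨ sum-cong (subsets n)
                                                                                                              (λ C → expand (μ C) (pointMass B′ C)
                                                                                                              (pointMass B C) (f C)) ⟩
    ΣS[ (λ C → μ C * f C + δ * (pointMass B′ C * f C - pointMass B C * f C)) ]                             ≡⟨ sum-+ (subsets n) _ _ ⟩
    ΣS[ (λ C → μ C * f C) ] + ΣS[ (λ C → δ * (pointMass B′ C * f C - pointMass B C * f C)) ]               ≡⟨ cong (ΣS[ (λ C → μ C * f C) ] +_)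
                                                                                                              (trans (sum-*ˡ (subsets n) δ _)
                                                                                                              (cong (δ *_) (sum-- (subsets n) _ _))) ⟩
    ΣS[ (λ C → μ C * f C) ] + δ * (ΣS[ (λ C → pointMass B′ C * f C) ] - ΣS[ (λ C → pointMass B C * f C) ]) ≡⟨ cong (λ x → ΣS[ (λ C → μ C * f C) ] + δ * x)
                                                                                                              (cong₂ _-_ (ΣS-pointMass B′ f) (ΣS-pointMass B f)) ⟩
    ΣS[ (λ C → μ C * f C) ] + δ * (f B′ - f B)                                                             ∎
    where
    open ≡-Reasoning
    expand : ∀ m p′ p x → (m + δ * (p′ - p)) * x ≡ m * x + δ * (p′ * x - p * x)
    expand m p′ p x = solve 5 (λ m p′ p x δ → (m :+ δ :* (p′ :- p)) :* x := m :* x :+ δ :* (p′ :* x :- p :* x)) refl m p′ p x δ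

  edgeUsage-transfer : ∀ μ B B′ δ e →
                       edgeUsage (transfer μ B B′ δ) e ≡ edgeUsage μ e + δ * (indicator B′ e - indicator B e)
  edgeUsage-transfer μ B B′ δ e =
    trans (edgeUsage-Σ (transfer μ B B′ δ) e) (trans (ΣS-transfer μ B B′ δ (λ C → indicator C e)) (cong (_+ _) (sym (edgeUsage-Σ μ e))))

  transfer-isPMF : ∀ {ind μ B B′ δ} → IsPMF ind μ → IsBase ind B → IsBase ind B′ → 0ℚ ≤ δ → δ ≤ μ B →
                   IsPMF ind (transfer μ B B′ δ)
  transfer-isPMF {ind} {μ} {B} {B′} {δ} (0≤μ , μ-off , Σμ≡1) B-base B′-base 0≤δ δ≤μB = nonNeg , off , total
    where
    nonNeg : ∀ C → 0ℚ ≤ transfer μ B B′ δ C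
    nonNeg C = subst (0ℚ ≤_) (rearrange (μ C) (pointMass B′ C) (pointMass B C))
                 (+-mono-≤ (removed C) (0≤p*q 0≤δ (0≤pointMass B′ C)))
      where
      rearrange : ∀ m p′ p → m - δ * p + δ * p′ ≡ m + δ * (p′ - p)
      rearrange m p′ p = solve 4 (λ m p′ p δ → m :- δ :* p :+ δ :* p′ := m :+ δ :* (p′ :- p)) refl m p′ p δ
      removed : ∀ C → 0ℚ ≤ μ C - δ * pointMass B C
      removed C with Vec.≡-dec Bool._≟_ C B
      ... | yes refl = subst (λ x → 0ℚ ≤ μ B - x) (sym (*-identityʳ δ)) (p≤q⇒0≤q-p δ≤μB)
      ... | no  C≢B  = subst (λ x → 0ℚ ≤ μ C - x) (sym (*-zeroʳ δ)) (subst (0ℚ ≤_) (sym (+-identityʳ (μ C))) (0≤μ C))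
    off : ∀ C → ¬ IsBase ind C → transfer μ B B′ δ C ≡ 0ℚ
    off C C-nonbase = begin
      μ C + δ * (pointMass B′ C - pointMass B C)  ≡⟨ cong₂ (λ m x → m + δ * x) (μ-off C C-nonbase)
                                                     (cong₂ _-_ (pointMass-other {B′} {C} (λ { refl → C-nonbase B′-base }))
                                                     (pointMass-other {B} {C} (λ { refl → C-nonbase B-base }))) ⟩
      0ℚ + δ * (0ℚ - 0ℚ)                          ≡⟨ solve 1 (λ δ → con 0ℚ :+ δ :* (con 0ℚ :- con 0ℚ) := con 0ℚ) refl δ ⟩
      0ℚ                                          ∎
      where open ≡-Reasoning
    total : ΣS[ transfer μ B B′ δ ] ≡ 1ℚ
    total = begin
      ΣS[ transfer μ B B′ δ ]                        ≡⟨ sum-cong (subsets n) (λ C → sym (*-identityʳ _)) ⟩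
      ΣS[ (λ C → transfer μ B B′ δ C * 1ℚ) ]         ≡⟨ ΣS-transfer μ B B′ δ (λ _ → 1ℚ) ⟩
      ΣS[ (λ C → μ C * 1ℚ) ] + δ * (1ℚ - 1ℚ)         ≡⟨ cong (_+ δ * (1ℚ - 1ℚ))
                                                        (trans (sum-cong (subsets n) (λ C → *-identityʳ (μ C))) Σμ≡1) ⟩
      1ℚ + δ * (1ℚ - 1ℚ)                             ≡⟨ solve 1 (λ δ → con 1ℚ :+ δ :* (con 1ℚ :- con 1ℚ) := con 1ℚ) refl δ ⟩
      1ℚ                                             ∎
      where open ≡-Reasoning

module OptimalMEO {n : ℕ} (M : Matroid n) {μ : Subset n → ℚ} (opt : IsOptimalMEO (Matroid.indep M) μ) where

  open Matroid M
  open MatroidProperties M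

  η : Fin n → ℚ
  η = edgeUsage μ

  μ-pmf : IsPMF indep μ
  μ-pmf = proj₁ opt

  support-isBase : ∀ {B} → ¬ μ B ≡ 0ℚ → IsBase indep B
  support-isBase {B} μB≢0 with isBase? B
  ... | yes B-base = B-base
  ... | no  ¬base  = ⊥-elim (μB≢0 (proj₁ (proj₂ μ-pmf) B ¬base))

  support-minimises-measure : ∀ {B B′} → ¬ μ B ≡ 0ℚ → IsBase indep B′ → measure η B ≤ measure η B′
  support-minimises-measure {B} {B′} μB≢0 B′-base = ≮⇒≥ improvable
    where
    D : ℚ
    D = measure η B - measure η B′
    d : Fin n → ℚ
    d e = indicator B′ e - indicator B e
    0<μB : 0ℚ < μ B
    0<μB = ≤∧≢⇒< (proj₁ μ-pmf B) (λ 0≡μB → μB≢0 (sym 0≡μB))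
    improvable : ¬ measure η B′ < measure η B
    improvable B′<B with ∃-small-step 0<μB (p<q⇒0<q-p B′<B) (sum-nonNeg (allFin n) (λ e → 0≤p*p (d e)))
    ... | δ , 0<δ , δ≤μB , δC≤D = <-irrefl refl (<-≤-trans decreased (proj₂ opt ν ν-pmf))
      where
      ν : Subset n → ℚ
      ν = transfer μ B B′ δ
      ν-pmf : IsPMF indep ν
      ν-pmf = transfer-isPMF μ-pmf (support-isBase μB≢0) B′-base (<⇒≤ 0<δ) δ≤μB
      meoObj-ν : meoObj ν ≡ meoObj μ + (δ + δ) * (- D) + δ * δ * energy d
      meoObj-ν = begin
        meoObj ν                                               ≡⟨ meoObj≡energy ν ⟩
        energy (edgeUsage ν)                                   ≡⟨ sum-cong (allFin n)
                                                                  (λ e → cong₂ _*_ (edgeUsage-transfer μ B B′ δ e)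
                                                                  (edgeUsage-transfer μ B B′ δ e)) ⟩
        energy (λ e → η e + δ * d e)                           ≡⟨ energy-shift η d δ ⟩
        energy η + (δ + δ) * dot η d + δ * δ * energy d        ≡⟨ cong₂ (λ E x → E + (δ + δ) * x + δ * δ * energy d) (sym (meoObj≡energy μ))
                                                                  (trans (dot-indicator-difference η B′ B)
                                                                  (solve 2 (λ b′ b → b′ :- b := :- (b :- b′)) refl (measure η B′)
                                                                  (measure η B))) ⟩
        meoObj μ + (δ + δ) * (- D) + δ * δ * energy d          ∎
        where open ≡-Reasoning
      decreased : meoObj ν < meoObj μ
      decreased = subst (_< meoObj μ) (sym meoObj-ν) (quadratic-step-decreases (meoObj μ) 0<δ (p<q⇒0<q-p B′<B) δC≤D)

≡const-if-energy≤-and-Σ≥ : ∀ {k} (ρ : Fin k → ℚ) c → 0ℚ ≤ c →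
                           energy ρ ≤ energy (λ (_ : Fin k) → c) → Σ[ (λ (_ : Fin k) → c) ] ≤ Σ[ ρ ] → ∀ j → ρ j ≡ c
≡const-if-energy≤-and-Σ≥ {k} ρ c 0≤c E≤K Σc≤Σρ j =
  trans (solve 2 (λ x c → x := (x :- c) :+ c) refl (ρ j) c)
        (trans (cong (_+ c) (p*p≤0⇒p≡0 (ρ j - c) (≤-trans (term≤sum (λ i → 0≤p*p (ρ i - c)) (∈-allFin j)) deviation≤0)))
               (+-identityˡ c))
  where
  E Σc Σρ : ℚ
  E = energy ρ
  Σc = Σ[ (λ (_ : Fin k) → c) ]
  Σρ = Σ[ ρ ]
  K≡ : energy (λ (_ : Fin k) → c) ≡ c * Σc
  K≡ = sum-*ˡ (allFin k) c (λ (_ : Fin k) → c)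
  deviation : Σ[ (λ i → (ρ i - c) * (ρ i - c)) ] ≡ E - (c + c) * Σρ + c * Σc
  deviation = begin
    Σ[ (λ i → (ρ i - c) * (ρ i - c)) ]                                     ≡⟨ sum-cong (allFin k)
                                                                              (λ i → solve 2
                                                                              (λ x c → (x :- c) :* (x :- c) := x :* x :- (c :+ c) :* x :+ c
                                                                              :* c) refl (ρ i) c) ⟩
    Σ[ (λ i → ρ i * ρ i - (c + c) * ρ i + c * c) ]                         ≡⟨ sum-+ (allFin k) _ _ ⟩
    Σ[ (λ i → ρ i * ρ i - (c + c) * ρ i) ] + energy (λ (_ : Fin k) → c)    ≡⟨ cong₂ _+_
                                                                              (trans (sum-- (allFin k) _ _)
                                                                              (cong (λ x → E - x) (sum-*ˡ (allFin k) (c + c) ρ))) K≡ ⟩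
    E - (c + c) * Σρ + c * Σc                                              ∎
    where open ≡-Reasoning
  deviation≤0 : Σ[ (λ i → (ρ i - c) * (ρ i - c)) ] ≤ 0ℚ
  deviation≤0 = begin
    Σ[ (λ i → (ρ i - c) * (ρ i - c)) ]    ≡⟨ deviation ⟩
    E - (c + c) * Σρ + c * Σc             ≤⟨ +-monoˡ-≤ (c * Σc)
                                             (+-mono-≤ (≤-trans E≤K (≤-reflexive K≡))
                                             (neg-antimono-≤ (*-monoˡ-≤-nonNeg (c + c) {{nonNegative (+-mono-≤ 0≤c 0≤c)}} Σc≤Σρ))) ⟩
    c * Σc - (c + c) * Σc + c * Σc        ≡⟨ solve 2 (λ c s → c :* s :- (c :+ c) :* s :+ c :* s := con 0ℚ) refl c Σc ⟩
    0ℚ                                    ∎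
    where open ≤-Reasoning

-- Contraction

module _ {k n : ℕ} (ι : Fin k → Fin n) where

  lookup-image : ∀ Y e → lookup (image ι Y) e ≡ any (λ j → lookup Y j ∧ ⌊ ι j Fin.≟ e ⌋) (allFin k)
  lookup-image Y e = Vec.lookup∘tabulate _ e

  ∈-image⁺ : ∀ {Y j} → j ∈ Y → ι j ∈ image ι Y
  ∈-image⁺ {Y} {j} j∈Y = Vec.lookup⇒[]= (ι j) (image ι Y)
    (trans (lookup-image Y (ι j)) (Equivalence.to T-≡ (any⁺ _ (Any.map (λ { refl → hit }) (∈-allFin j)))))
    where
    hit : T (lookup Y j ∧ ⌊ ι j Fin.≟ ι j ⌋)
    hit = Equivalence.from T-≡ (cong₂ _∧_ (Vec.[]=⇒lookup j∈Y) (⌊⌋-true (ι j Fin.≟ ι j) refl))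

  ∈-image⁻ : ∀ {Y e} → e ∈ image ι Y → ∃[ j ] (j ∈ Y × ι j ≡ e)
  ∈-image⁻ {Y} {e} e∈image
    with satisfied (any⁻ _ (allFin k) (Equivalence.from T-≡ (trans (sym (lookup-image Y e)) (Vec.[]=⇒lookup e∈image))))
  ... | j , hit with Equivalence.to T-∧ hit
  ...   | j∈Y , ιj≡e = j , Vec.lookup⇒[]= j Y (Equivalence.to T-≡ j∈Y) , toWitness ιj≡e

  image-∪-⁅⁆ : ∀ Y j → image ι (Y ∪ ⁅ j ⁆) ≡ image ι Y ∪ ⁅ ι j ⁆
  image-∪-⁅⁆ Y j = ⊆-antisym ⊆-direction ⊇-direction
    where
    ⊆-direction : image ι (Y ∪ ⁅ j ⁆) ⊆ image ι Y ∪ ⁅ ι j ⁆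
    ⊆-direction e∈ with ∈-image⁻ e∈
    ... | i , i∈Y∪j , refl with x∈p∪q⁻ Y ⁅ j ⁆ i∈Y∪j
    ...   | inj₁ i∈Y = p⊆p∪q ⁅ ι j ⁆ (∈-image⁺ {Y} i∈Y)
    ...   | inj₂ i∈j = q⊆p∪q (image ι Y) ⁅ ι j ⁆ (subst (λ i → ι i ∈ ⁅ ι j ⁆) (sym (x∈⁅y⁆⇒x≡y j i∈j)) (x∈⁅x⁆ (ι j)))
    ⊇-direction : image ι Y ∪ ⁅ ι j ⁆ ⊆ image ι (Y ∪ ⁅ j ⁆)
    ⊇-direction = ∪-lub image-mono (x∈p⇒⁅x⁆⊆p (∈-image⁺ {Y ∪ ⁅ j ⁆} (q⊆p∪q Y ⁅ j ⁆ (x∈⁅x⁆ j))))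
      where
      image-mono : image ι Y ⊆ image ι (Y ∪ ⁅ j ⁆)
      image-mono e∈ with ∈-image⁻ e∈
      ... | i , i∈Y , refl = ∈-image⁺ {Y ∪ ⁅ j ⁆} (p⊆p∪q ⁅ j ⁆ i∈Y)

  preimage : Subset n → Subset k
  preimage B = tabulate (λ j → lookup B (ι j))

  indicator-preimage : ∀ B j → indicator (preimage B) j ≡ indicator B (ι j)
  indicator-preimage B j = cong (if_then 1ℚ else 0ℚ) (Vec.lookup∘tabulate _ j)

module _ {k n : ℕ} {ι : Fin k → Fin n} {X : Subset n} (enum : Enumerates ι X) where

  private
    ι-injective : ∀ i j → ι i ≡ ι j → i ≡ j
    ι-injective = proj₁ enum

    ι∈X : ∀ j → ι j ∈ X
    ι∈X j = Equivalence.from (proj₂ enum (ι j)) (j , refl)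

    X⊆imι : ∀ {e} → e ∈ X → ∃[ j ] ι j ≡ e
    X⊆imι {e} = Equivalence.to (proj₂ enum e)

    preimage-count : ∀ e → Σ[ (λ j → indicator ⁅ ι j ⁆ e) ] ≡ indicator X e
    preimage-count e with e ∈? X
    ... | no e∉X = trans (sum-cong (allFin k) (λ j → indicator-∉ (λ e∈ιj → e∉X (subst (_∈ X) (sym (x∈⁅y⁆⇒x≡y (ι j) e∈ιj)) (ι∈X j)))))
                         (trans (sum-zero (allFin k)) (sym (indicator-∉ e∉X)))
    ... | yes e∈X with X⊆imι e∈X
    ...   | j₀ , refl = trans (Σ-delta _ j₀ (λ j j≢j₀ → indicator-∉ (λ ιj₀∈ιj → j≢j₀ (ι-injective j j₀ (sym (x∈⁅y⁆⇒x≡y (ι j) ιj₀∈ιj))))))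
                              (trans (indicator-∈ (x∈⁅x⁆ (ι j₀))) (sym (indicator-∈ e∈X)))

  Σ-reindex : ∀ (g : Fin n → ℚ) → Σ[ (λ j → g (ι j)) ] ≡ measure g X
  Σ-reindex g = begin
    Σ[ (λ j → g (ι j)) ]                                      ≡⟨ sum-cong (allFin k)
                                                                 (λ j → sym (trans (sym (measure-Σ g ⁅ ι j ⁆)) (measure-⁅⁆ g (ι j)))) ⟩
    Σ[ (λ j → Σ[ (λ e → indicator ⁅ ι j ⁆ e * g e) ]) ]       ≡⟨ sum-swap (allFin k) (allFin n) _ ⟩
    Σ[ (λ e → Σ[ (λ j → indicator ⁅ ι j ⁆ e * g e) ]) ]       ≡⟨ sum-cong (allFin n)
                                                                 (λ e → trans (sum-cong (allFin k) (λ j → *-comm _ (g e)))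
                                                                 (trans (sum-*ˡ (allFin k) (g e) _)
                                                                 (trans (cong (g e *_) (preimage-count e)) (*-comm (g e) _)))) ⟩
    Σ[ (λ e → indicator X e * g e) ]                          ≡⟨ sym (measure-Σ g X) ⟩
    measure g X                                               ∎
    where open ≡-Reasoning

  ∣preimage∣ : ∀ B → ∣ preimage ι B ∣ ≡ ∣ X ∩ B ∣
  ∣preimage∣ B = fromℕ-injective (begin
    fromℕ ∣ preimage ι B ∣                 ≡⟨ card≡Σindicator (preimage ι B) ⟩
    Σ[ indicator (preimage ι B) ]          ≡⟨ sum-cong (allFin k) (indicator-preimage ι B) ⟩
    Σ[ (λ j → indicator B (ι j)) ]         ≡⟨ Σ-reindex (indicator B) ⟩
    measure (indicator B) X                ≡⟨ measure-indicator X B ⟩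
    fromℕ ∣ X ∩ B ∣                        ∎)
    where open ≡-Reasoning

  ⊆-image-preimage : ∀ B → B ⊆ image ι (preimage ι B) ∪ ∁ X
  ⊆-image-preimage B {e} e∈B with e ∈? X
  ... | no  e∉X = q⊆p∪q _ (∁ X) (x∉p⇒x∈∁p e∉X)
  ... | yes e∈X with X⊆imι e∈X
  ...   | j , refl = p⊆p∪q (∁ X) (∈-image⁺ ι (Vec.lookup⇒[]= j (preimage ι B) (trans (Vec.lookup∘tabulate _ j) (Vec.[]=⇒lookup e∈B))))

module ContractionProperties {n : ℕ} (M : Matroid n) {k} {ι : Fin k → Fin n} {X : Subset n} (enum : Enumerates ι X) where

  open Matroid M
  open MatroidProperties M

  N : Subset k → Bool
  N = contractIndep M X ι

  rX : ℕ
  rX = r (∁ X)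

  lift : Subset k → Subset n
  lift Y = image ι Y ∪ ∁ X

  rX≤r-lift : ∀ Y → rX ℕ.≤ r (lift Y)
  rX≤r-lift Y = rank-mono (q⊆p∪q (image ι Y) (∁ X))

  N-indep⁻ : ∀ {Y} → N Y ≡ true → r (lift Y) ∸ rX ≡ ∣ Y ∣
  N-indep⁻ {Y} = ⌊⌋-true⁻ (r (lift Y) ∸ rX ℕ.≟ ∣ Y ∣)

  N-indep⁺ : ∀ {Y} → r (lift Y) ∸ rX ≡ ∣ Y ∣ → N Y ≡ true
  N-indep⁺ {Y} = ⌊⌋-true (r (lift Y) ∸ rX ℕ.≟ ∣ Y ∣)

  N-indep-small : ∀ {Y} → N Y ≡ true → ∣ Y ∣ ℕ.≤ r ⊤ ∸ rX
  N-indep-small {Y} Y-indep = subst (ℕ._≤ r ⊤ ∸ rX) (N-indep⁻ {Y} Y-indep) (ℕ.∸-monoˡ-≤ rX (rank≤rank⊤ (lift Y)))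

  N-full⇒base : ∀ {Y} → N Y ≡ true → ∣ Y ∣ ≡ r ⊤ ∸ rX → IsBase N Y
  N-full⇒base {Y} Y-indep ∣Y∣≡ = Y-indep , maximal
    where
    maximal : ∀ j → j ∉ Y → N (Y ∪ ⁅ j ⁆) ≡ false
    maximal j j∉Y with N (Y ∪ ⁅ j ⁆) in Y+j-indep
    ... | false = refl
    ... | true  = ⊥-elim (ℕ.<-irrefl refl (begin-strict
      ∣ Y ∣            <⟨ ℕ.n<1+n ∣ Y ∣ ⟩
      suc ∣ Y ∣        ≡⟨ sym (∣p∪⁅x⁆∣≡1+∣p∣ {p = Y} j∉Y) ⟩
      ∣ Y ∪ ⁅ j ⁆ ∣    ≤⟨ N-indep-small {Y ∪ ⁅ j ⁆} Y+j-indep ⟩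
      r ⊤ ∸ rX         ≡⟨ sym ∣Y∣≡ ⟩
      ∣ Y ∣            ∎))
      where open ℕ.≤-Reasoning

  N-basis-large : ∀ {Y} → IsBase N Y → r ⊤ ∸ rX ℕ.≤ ∣ Y ∣
  N-basis-large {Y} (Y-indep , Y-maximal) with ℕ.<-≤-connex (r (lift Y)) (r ⊤)
  ... | inj₂ r⊤≤ = subst (r ⊤ ∸ rX ℕ.≤_) (N-indep⁻ {Y} Y-indep) (ℕ.∸-monoˡ-≤ rX r⊤≤)
  ... | inj₁ r<r⊤ with rank-increase r<r⊤
  ...   | e , e∉lift , rank-jumps with Equivalence.to (proj₂ enum e) (x∉∁p⇒x∈p (e∉lift ∘ q⊆p∪q (image ι Y) (∁ X)))
  ...     | j , refl = contradiction (trans (sym (N-indep⁺ {Y ∪ ⁅ j ⁆} Y+j-full)) (Y-maximal j j∉Y)) λ ()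
    where
    j∉Y : j ∉ Y
    j∉Y j∈Y = e∉lift (p⊆p∪q (∁ X) (∈-image⁺ ι j∈Y))
    lift-∪-⁅⁆ : lift (Y ∪ ⁅ j ⁆) ≡ lift Y ∪ ⁅ ι j ⁆
    lift-∪-⁅⁆ = begin
      image ι (Y ∪ ⁅ j ⁆) ∪ ∁ X           ≡⟨ cong (_∪ ∁ X) (image-∪-⁅⁆ ι Y j) ⟩
      (image ι Y ∪ ⁅ ι j ⁆) ∪ ∁ X         ≡⟨ ∪-assoc (image ι Y) ⁅ ι j ⁆ (∁ X) ⟩
      image ι Y ∪ (⁅ ι j ⁆ ∪ ∁ X)         ≡⟨ cong (image ι Y ∪_) (∪-comm ⁅ ι j ⁆ (∁ X)) ⟩
      image ι Y ∪ (∁ X ∪ ⁅ ι j ⁆)         ≡⟨ sym (∪-assoc (image ι Y) (∁ X) ⁅ ι j ⁆) ⟩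
      (image ι Y ∪ ∁ X) ∪ ⁅ ι j ⁆         ∎
      where open ≡-Reasoning
    Y+j-full : r (lift (Y ∪ ⁅ j ⁆)) ∸ rX ≡ ∣ Y ∪ ⁅ j ⁆ ∣
    Y+j-full = begin
      r (lift (Y ∪ ⁅ j ⁆)) ∸ rX    ≡⟨ cong (λ A → r A ∸ rX) lift-∪-⁅⁆ ⟩
      r (lift Y ∪ ⁅ ι j ⁆) ∸ rX    ≡⟨ cong (_∸ rX) rank-jumps ⟩
      suc (r (lift Y)) ∸ rX        ≡⟨ ℕ.+-∸-assoc 1 (rX≤r-lift Y) ⟩
      suc (r (lift Y) ∸ rX)        ≡⟨ cong suc (N-indep⁻ {Y} Y-indep) ⟩
      suc ∣ Y ∣                    ≡⟨ sym (∣p∪⁅x⁆∣≡1+∣p∣ {p = Y} j∉Y) ⟩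
      ∣ Y ∪ ⁅ j ⁆ ∣                ∎
      where open ≡-Reasoning

  preimage-isBase : ∀ {B} → IsBase indep B → ∣ X ∩ B ∣ ≡ r ⊤ ∸ rX → IsBase N (preimage ι B)
  preimage-isBase {B} B-base ∣X∩B∣≡ = N-full⇒base {preimage ι B} (N-indep⁺ {preimage ι B} full) ∣preimage∣≡
    where
    ∣preimage∣≡ : ∣ preimage ι B ∣ ≡ r ⊤ ∸ rX
    ∣preimage∣≡ = trans (∣preimage∣ enum B) ∣X∩B∣≡
    spans : r (lift (preimage ι B)) ≡ r ⊤
    spans = ℕ.≤-antisym (rank≤rank⊤ _) (subst (ℕ._≤ r (lift (preimage ι B))) (base-card B-base) (indep⊆⇒∣∣≤rank (proj₁ B-base) (⊆-image-preimage enum B)))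
    full : r (lift (preimage ι B)) ∸ rX ≡ ∣ preimage ι B ∣
    full = trans (cong (_∸ rX) spans) (sym ∣preimage∣≡)

module BeurlingSet {n : ℕ} (M : Matroid n) (0<r⊤ : 0 ℕ.< rank M ⊤) {μ : Subset n → ℚ} (opt : IsOptimalMEO (Matroid.indep M) μ) where

  open Matroid M
  open MatroidProperties M
  open OptimalMEO M opt

  ηmax : ℚ
  ηmax = maxℚ η

  X : Subset n
  X = argmaxSet η

  contractedRank : Subset n → ℚ
  contractedRank A = fromℕ (r ⊤) - fromℕ (r (∁ A))

  contractedRank≤measure : ∀ A → contractedRank A ≤ measure η A
  contractedRank≤measure A = subst (contractedRank A ≤_) (sym (measure-edgeUsage μ A)) (support-average-≥ μ-pmf (contractedRank A) _ meets)
    where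
    meets : ∀ B → ¬ μ B ≡ 0ℚ → contractedRank A ≤ fromℕ ∣ A ∩ B ∣
    meets B μB≢0 = begin
      fromℕ (r ⊤) - fromℕ (r (∁ A))                           ≤⟨ +-monoˡ-≤ (- fromℕ (r (∁ A)))
                                                                 (fromℕ-mono-≤ (base-meets (support-isBase μB≢0) A)) ⟩
      fromℕ (∣ A ∩ B ∣ ℕ.+ r (∁ A)) - fromℕ (r (∁ A))         ≡⟨ cong (_- fromℕ (r (∁ A))) (fromℕ-+ ∣ A ∩ B ∣ (r (∁ A))) ⟩
      fromℕ ∣ A ∩ B ∣ + fromℕ (r (∁ A)) - fromℕ (r (∁ A))     ≡⟨ solve 2 (λ a b → a :+ b :- b := a) refl (fromℕ ∣ A ∩ B ∣) (fromℕ (r (∁ A))) ⟩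
      fromℕ ∣ A ∩ B ∣                                         ∎
      where open ≤-Reasoning

  contractedRank≤ηmax*card : ∀ A → contractedRank A ≤ ηmax * fromℕ ∣ A ∣
  contractedRank≤ηmax*card A = ≤-trans (contractedRank≤measure A) (measure-≤-const η A ηmax (≤-maxℚ η))

  contractedRank-⊤ : contractedRank ⊤ ≡ fromℕ (r ⊤)
  contractedRank-⊤ = trans (cong (λ k → fromℕ (r ⊤) - fromℕ k) r∁⊤≡0) (+-identityʳ (fromℕ (r ⊤)))
    where
    r∁⊤≡0 : r (∁ ⊤) ≡ 0
    r∁⊤≡0 = ℕ.n≤0⇒n≡0 (ℕ.≤-trans (rank≤card (∁ ⊤)) (ℕ.≤-reflexive (trans (∣∁p∣≡n∸∣p∣ (⊤ {n})) (trans (cong (n ∸_) (∣⊤∣≡n n)) (ℕ.n∸n≡0 n)))))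

  r⊤≤ηmax*n : fromℕ (r ⊤) ≤ ηmax * fromℕ n
  r⊤≤ηmax*n = subst₂ _≤_ contractedRank-⊤ (cong (λ k → ηmax * fromℕ k) (∣⊤∣≡n n)) (contractedRank≤ηmax*card ⊤)

  0<ηmax : 0ℚ < ηmax
  0<ηmax = ≰⇒> ηmax≰0
    where
    ηmax≰0 : ¬ ηmax ≤ 0ℚ
    ηmax≰0 ηmax≤0 = <-irrefl refl (<-≤-trans (fromℕ-mono-< 0<r⊤) (≤-trans r⊤≤ηmax*n
      (nonPositive⁻¹ (ηmax * fromℕ n) {{nonPos*nonNeg⇒nonPos ηmax {{nonPositive ηmax≤0}} (fromℕ n) {{nonNegative (0≤fromℕ n)}}}})))

  support-meets-X : ∀ {B} → ¬ μ B ≡ 0ℚ → ∣ X ∩ B ∣ ≡ r ⊤ ∸ r (∁ X)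
  support-meets-X {B} μB≢0 = begin
    ∣ X ∩ B ∣                                 ≡⟨ sym (ℕ.m+n∸n≡m ∣ X ∩ B ∣ (r (∁ X))) ⟩
    ∣ X ∩ B ∣ ℕ.+ r (∁ X) ∸ r (∁ X)           ≡⟨ cong (_∸ r (∁ X))
                                                 (cong₂ ℕ._+_ (cong ∣_∣ (∩-comm X B))
                                                 (sym (minimum-base-spans-below-max M η B-base (support-minimises-measure μB≢0)))) ⟩
    ∣ B ∩ X ∣ ℕ.+ ∣ B ∩ ∁ X ∣ ∸ r (∁ X)       ≡⟨ cong (_∸ r (∁ X)) (sym (∣p∣≡∣p∩q∣+∣p∩∁q∣ B X)) ⟩
    ∣ B ∣ ∸ r (∁ X)                           ≡⟨ cong (_∸ r (∁ X)) (base-card B-base) ⟩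
    r ⊤ ∸ r (∁ X)                             ∎
    where
    open ≡-Reasoning
    B-base : IsBase indep B
    B-base = support-isBase μB≢0

  measure-X≡contractedRank : measure η X ≡ contractedRank X
  measure-X≡contractedRank = trans (measure-edgeUsage μ X) (support-average-≡ μ-pmf (contractedRank X) _ meets-X)
    where
    meets-X : ∀ B → ¬ μ B ≡ 0ℚ → fromℕ ∣ X ∩ B ∣ ≡ contractedRank X
    meets-X B μB≢0 = trans (cong fromℕ (support-meets-X μB≢0)) (fromℕ-∸ (rank≤rank⊤ (∁ X)))

  measure-X≡ηmax*card : measure η X ≡ ηmax * fromℕ ∣ X ∣
  measure-X≡ηmax*card = measure-const η X ηmax (∈-argmax⇒≡max η)

  0<∣X∣ : 0ℚ < fromℕ ∣ X ∣
  0<∣X∣ = fromℕ-mono-< {0} {∣ X ∣} (x∈p⇒0<∣p∣ (proj₂ (argmax-nonempty η 0<ηmax)))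

  contractedRank-X≡ηmax*card : contractedRank X ≡ ηmax * fromℕ ∣ X ∣
  contractedRank-X≡ηmax*card = trans (sym measure-X≡contractedRank) measure-X≡ηmax*card

  0<contractedRank-X : 0ℚ < contractedRank X
  0<contractedRank-X = subst (0ℚ <_) (sym contractedRank-X≡ηmax*card) (0<p*q 0<ηmax 0<∣X∣)

  ηmax≡contractedRank/card : ηmax ≡ divℚ (contractedRank X) (fromℕ ∣ X ∣)
  ηmax≡contractedRank/card = sym (divℚ-unique ηmax 0<∣X∣ (sym contractedRank-X≡ηmax*card))

  ∁X-closed : cl M (∁ X) ≡ ∁ X
  ∁X-closed = closed-if-rank-jumps (∁ X) jumps
    where
    jumps : ∀ {y} → y ∉ ∁ X → ¬ r (∁ X ∪ ⁅ y ⁆) ≡ r (∁ X)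
    jumps {y} y∉∁X = jumps-via (edgeUsage≢0⇒∈support μ ηy≢0)
      where
      ηy≢0 : ¬ η y ≡ 0ℚ
      ηy≢0 ηy≡0 = <-irrefl (trans (sym ηy≡0) (∈-argmax⇒≡max η (x∉∁p⇒x∈p y∉∁X))) 0<ηmax
      jumps-via : ∃[ B ] (¬ μ B ≡ 0ℚ × y ∈ B) → ¬ r (∁ X ∪ ⁅ y ⁆) ≡ r (∁ X)
      jumps-via (B , μB≢0 , y∈B) r-equal = ℕ.<-irrefl (sym r-equal) (begin-strict
        r (∁ X)                       ≡⟨ sym (minimum-base-spans-below-max M η B-base (support-minimises-measure μB≢0)) ⟩
        ∣ B ∩ ∁ X ∣                   <⟨ ℕ.n<1+n ∣ B ∩ ∁ X ∣ ⟩
        suc ∣ B ∩ ∁ X ∣               ≡⟨ sym (∣p∪⁅x⁆∣≡1+∣p∣ {p = B ∩ ∁ X} (y∉∁X ∘ p∩q⊆q B (∁ X))) ⟩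
        ∣ B ∩ ∁ X ∪ ⁅ y ⁆ ∣           ≤⟨ indep⊆⇒∣∣≤rank (indep-↓ (∪-lub (p∩q⊆p B (∁ X)) (x∈p⇒⁅x⁆⊆p y∈B)) (proj₁ B-base))
                                                       (∪-lub (p⊆p∪q ⁅ y ⁆ ∘ p∩q⊆q B (∁ X)) (q⊆p∪q (∁ X) ⁅ y ⁆)) ⟩
        r (∁ X ∪ ⁅ y ⁆)               ∎)
        where
        open ℕ.≤-Reasoning
        B-base : IsBase indep B
        B-base = support-isBase μB≢0

  ratio : Subset n → ℚ
  ratio A = divℚ (fromℕ ∣ A ∣) (contractedRank A)

  1/ηmax≤ratio : ∀ A → r (∁ A) ℕ.< r ⊤ → divℚ 1ℚ ηmax ≤ ratio A
  1/ηmax≤ratio A r∁A<r⊤ = 1/c≤a/d 0<ηmax (p<q⇒0<q-p (fromℕ-mono-< r∁A<r⊤)) (contractedRank≤ηmax*card A)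

  ratio-X : ratio X ≡ divℚ 1ℚ ηmax
  ratio-X = divℚ-unique (divℚ 1ℚ ηmax) 0<contractedRank-X (begin
    divℚ 1ℚ ηmax * contractedRank X                    ≡⟨ cong (divℚ 1ℚ ηmax *_) contractedRank-X≡ηmax*card ⟩
    divℚ 1ℚ ηmax * (ηmax * fromℕ ∣ X ∣)                ≡⟨ sym (*-assoc (divℚ 1ℚ ηmax) ηmax (fromℕ ∣ X ∣)) ⟩
    divℚ 1ℚ ηmax * ηmax * fromℕ ∣ X ∣                  ≡⟨ cong (_* fromℕ ∣ X ∣) (divℚ-*-cancel 1ℚ 0<ηmax) ⟩
    1ℚ * fromℕ ∣ X ∣                                   ≡⟨ *-identityˡ (fromℕ ∣ X ∣) ⟩
    fromℕ ∣ X ∣                                        ∎)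
    where open ≡-Reasoning

  strength≡1/ηmax : strength M ≡ divℚ 1ℚ ηmax
  strength≡1/ηmax = ≤-antisym (≤-trans (foldr-⊓-≤ ratio X-candidate) (≤-reflexive ratio-X))
                              (≤-foldr-⊓ ratio candidates seed-bound (λ A∈ → 1/ηmax≤ratio _ (proj₂ (∈-filter⁻ is-candidate? {xs = subsets n} A∈))))
    where
    is-candidate? : ∀ A → Dec (r (∁ A) ℕ.< r ⊤)
    is-candidate? A = r (∁ A) ℕ.<? r ⊤
    candidates : List (Subset n)
    candidates = filter is-candidate? (subsets n)
    X-candidate : X ∈ₗ candidates
    X-candidate = ∈-filter⁺ is-candidate? (∈-subsets X) (fromℕ-cancel-< (0<q-p⇒p<q 0<contractedRank-X))
    -- the seed n / r(E) of the minimum defining the strength is the ratio for A = E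
    seed-bound : divℚ 1ℚ ηmax ≤ divℚ (fromℕ n) (fromℕ (r ⊤))
    seed-bound = 1/c≤a/d 0<ηmax (fromℕ-mono-< 0<r⊤) r⊤≤ηmax*n

  ηmax≡1/strength : ηmax ≡ divℚ 1ℚ (strength M)
  ηmax≡1/strength = sym (trans (cong (divℚ 1ℚ) strength≡1/ηmax)
    (divℚ-unique ηmax (divℚ-pos (positive⁻¹ 1ℚ) 0<ηmax) (trans (*-comm ηmax (divℚ 1ℚ ηmax)) (divℚ-*-cancel 1ℚ 0<ηmax))))

  module _ {k : ℕ} {ι : Fin k → Fin n} (enum : Enumerates ι X) where

    open ContractionProperties M enum

    Σ-ηmax≡contractedRank-X : Σ[ (λ (_ : Fin k) → ηmax) ] ≡ contractedRank X
    Σ-ηmax≡contractedRank-X = begin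
      Σ[ (λ (_ : Fin k) → ηmax) ]              ≡⟨ sum-cong (allFin k)
                                                  (λ j → sym (∈-argmax⇒≡max η (Equivalence.from (proj₂ enum (ι j)) (j , refl)))) ⟩
      Σ[ (λ j → η (ι j)) ]                     ≡⟨ Σ-reindex enum η ⟩
      measure η X                              ≡⟨ measure-X≡contractedRank ⟩
      contractedRank X                         ∎
      where open ≡-Reasoning

    ηmax∈BL : BL (Adm (BaseFamily N)) (λ _ → ηmax)
    ηmax∈BL = (λ _ → <⇒≤ 0<ηmax) , blocks
      where
      blocks : ∀ ρ → Adm (BaseFamily N) ρ → 1ℚ ≤ dot (λ _ → ηmax) ρ
      blocks ρ (_ , ρ-blocks) = begin
        1ℚ                                                          ≤⟨ support-average-≥ μ-pmf 1ℚ _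
                                                                       (λ B μB≢0 → ρ-blocks _
                                                                       (preimage ι B , preimage-isBase (support-isBase μB≢0)
                                                                       (support-meets-X μB≢0) , λ _ → refl)) ⟩
        ΣS[ (λ B → μ B * dot (indicator (preimage ι B)) ρ) ]        ≡⟨ sum-cong (subsets n)
                                                                       (λ B → cong (μ B *_)
                                                                       (sum-cong (allFin k)
                                                                       (λ j → trans (cong (_* ρ j) (indicator-preimage ι B j))
                                                                       (*-comm _ (ρ j))))) ⟩
        ΣS[ (λ B → μ B * Σ[ (λ j → ρ j * indicator B (ι j)) ]) ]    ≡⟨ sym (sum-edgeUsage μ (allFin k) ρ ι) ⟩
        Σ[ (λ j → ρ j * η (ι j)) ]                                  ≡⟨ sum-cong (allFin k)
                                                                       (λ j → trans
                                                                       (cong (ρ j *_)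
                                                                       (∈-argmax⇒≡max η (Equivalence.from (proj₂ enum (ι j)) (j , refl))))
                                                                       (*-comm (ρ j) ηmax)) ⟩
        dot (λ _ → ηmax) ρ                                          ∎
        where open ≤-Reasoning

    uniform∈Adm : Adm (BaseFamily N) (λ _ → divℚ 1ℚ (contractedRank X))
    uniform∈Adm = (λ _ → <⇒≤ 0<t) , meets-bases
      where
      t : ℚ
      t = divℚ 1ℚ (contractedRank X)
      0<t : 0ℚ < t
      0<t = divℚ-pos (positive⁻¹ 1ℚ) 0<contractedRank-X
      meets-bases : ∀ γ → BaseFamily N γ → 1ℚ ≤ dot γ (λ _ → t)
      meets-bases γ (Y , Y-base , γ≡) = begin
        1ℚ                                      ≡⟨ sym (divℚ-*-cancel 1ℚ 0<contractedRank-X) ⟩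
        t * contractedRank X                    ≤⟨ *-monoˡ-≤-nonNeg t {{nonNegative (<⇒≤ 0<t)}}
                                                   (subst (_≤ fromℕ ∣ Y ∣) (fromℕ-∸ (rank≤rank⊤ (∁ X)))
                                                   (fromℕ-mono-≤ (N-basis-large Y-base))) ⟩
        t * fromℕ ∣ Y ∣                         ≡⟨ cong (t *_) (card≡Σindicator Y) ⟩
        t * Σ[ indicator Y ]                    ≡⟨ sym (sum-*ˡ (allFin k) t (indicator Y)) ⟩
        Σ[ (λ j → t * indicator Y j) ]          ≡⟨ sum-cong (allFin k) (λ j → trans (*-comm t _) (cong (_* t) (sym (γ≡ j)))) ⟩
        dot γ (λ _ → t)                         ∎
        where open ≤-Reasoning

    contraction-homogeneous : Homogeneous N
    contraction-homogeneous Γ̃ (_ , Adm⇔BL) ρ (ρ-adm , ρ-min) e e′ = trans (ρ≡ηmax e) (sym (ρ≡ηmax e′))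
      where
      t Σρ : ℚ
      t = divℚ 1ℚ (contractedRank X)
      Σρ = Σ[ ρ ]
      contractedRank≤Σρ : contractedRank X ≤ Σρ
      contractedRank≤Σρ = begin
        contractedRank X                        ≡⟨ sym (*-identityʳ (contractedRank X)) ⟩
        contractedRank X * 1ℚ                   ≤⟨ *-monoˡ-≤-nonNeg (contractedRank X) {{nonNegative (<⇒≤ 0<contractedRank-X)}}
                                                   (proj₂ (Equivalence.to (Adm⇔BL ρ) ρ-adm) _ uniform∈Adm) ⟩
        contractedRank X * dot ρ (λ _ → t)      ≡⟨ cong (contractedRank X *_) (sum-*ʳ-const) ⟩
        contractedRank X * (Σρ * t)             ≡⟨ solve 3 (λ g s t → g :* (s :* t) := s :* (t :* g)) refl (contractedRank X) Σρ t ⟩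
        Σρ * (t * contractedRank X)             ≡⟨ cong (Σρ *_) (divℚ-*-cancel 1ℚ 0<contractedRank-X) ⟩
        Σρ * 1ℚ                                 ≡⟨ *-identityʳ Σρ ⟩
        Σρ                                      ∎
        where
        open ≤-Reasoning
        sum-*ʳ-const : dot ρ (λ _ → t) ≡ Σρ * t
        sum-*ʳ-const = trans (sum-cong (allFin k) (λ j → *-comm (ρ j) t)) (trans (sum-*ˡ (allFin k) t ρ) (*-comm t Σρ))
      ρ≡ηmax : ∀ j → ρ j ≡ ηmax
      ρ≡ηmax = ≡const-if-energy≤-and-Σ≥ ρ ηmax (<⇒≤ 0<ηmax) (ρ-min _ (Equivalence.from (Adm⇔BL _) ηmax∈BL))
                                        (subst (_≤ Σρ) (sym Σ-ηmax≡contractedRank-X) contractedRank≤Σρ)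

theorem4p1 : ∀ {n} (M : Matroid n) → Loopless M → 0 ℕ.< rank M ⊤ →
  (Γ̃ : Family n) → FulkersonDual Γ̃ (BaseFamily (Matroid.indep M)) →
  (μ : Subset n → ℚ) → IsOptimalMEO (Matroid.indep M) μ →
  let η = edgeUsage μ
      ηmax = maxℚ η
      X = argmaxSet η
  in (measure η X ≡ fromℕ (rank M ⊤) - fromℕ (rank M (∁ X)))
     × (cl M (∁ X) ≡ ∁ X)
     × (ηmax ≡ divℚ (fromℕ (rank M ⊤) - fromℕ (rank M (∁ X))) (fromℕ ∣ X ∣))
     × (ηmax ≡ divℚ 1ℚ (strength M))
     × (∀ {k} (ι : Fin k → Fin n) → Enumerates ι X →
          Homogeneous (contractIndep M X ι))
theorem4p1 M _ 0<r⊤ _ _ μ opt =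
  measure-X≡contractedRank , ∁X-closed , ηmax≡contractedRank/card , ηmax≡1/strength , λ _ → contraction-homogeneous
  where open BeurlingSet M 0<r⊤ opt
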